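{- For $n\geq 1$, $a_n(312;231) = \displaystyle\sum_{k=0}^{\lfloor (n-1)/3\rfloor}\binom{n-1-k}{2k}$.
   Context: $\mathcal{S}_n$ is the set of permutations of $[n]=\{1,\dots,n\}$, written in one-line notation $\pi=\pi_1\pi_2\cdots\pi_n$ with $\pi_i=\pi(i)$. A permutation is cyclic if it consists of exactly one $n$-cycle. For a cyclic $\pi$, its standard cycle notation is $C(\pi)=(c_1,c_2,\dots,c_n)$ with $c_1=1$ and $c_i=\pi_{c_{i-1}}$ for $2\le i\le n$. A sequence of distinct integers $w_1\cdots w_m$ contains a pattern $\sigma\in\mathcal{S}_k$ if there are indices $i_1<\dots<i_k$ with $w_{i_1}\cdots w_{i_k}$ in the same relative order as $\sigma_1\cdots\sigma_k$; otherwise it avoids $\sigma$. For $\sigma,\tau\in\mathcal{S}_3$, $\mathcal{A}_n(\sigma;\tau)$ is the set of cyclic permutations $\pi\in\mathcal{S}_n$ whose one-line notation avoids $\sigma$ and whose cycle notation $C(\pi)$ (as the sequence $c_1c_2\cdots c_n$) avoids $\tau$; $a_n(\sigma;\tau)=|\mathcal{A}_n(\sigma;\tau)|$. -}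

module Defs where

open import Data.Nat using (ℕ; zero; suc; _<_; _*_; _∸_; _/_)
open import Data.Nat.Combinatorics using (_C_)
open import Data.Fin using (Fin; toℕ) renaming (zero to fzero; _<_ to _<ᶠ_)
open import Data.Vec using (Vec; lookup; tabulate; _∷_; [])
open import Data.List using (List; length; map; upTo)
open import Data.Nat.ListAction using (sum)
open import Relation.Nullary using (¬_)
open import Data.List.Membership.Propositional using (_∈_)
open import Data.List.Relation.Unary.Unique.Propositional using (Unique)
open import Data.Product using (Σ; _×_; ∃)
open import Function using (_⇔_)
open import Function.Definitions using (Injective)
open import Relation.Binary.PropositionalEquality using (_≡_)

-- Convention: a permutation of [n] is given in one-line notation as a
-- vector π : Vec (Fin n) n, where the value/position j : Fin n stands
-- for the integer (toℕ j) + 1 ∈ [n].  π_i = lookup π i.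

app : ∀ {n} → Vec (Fin n) n → Fin n → Fin n
app π = lookup π

iter : ∀ {A : Set} → (A → A) → ℕ → A → A
iter f zero    x = x
iter f (suc k) x = f (iter f k x)

-- π is a permutation of [n] (the one-line word has no repeated values;
-- an injective self-map of a finite set is a bijection)
IsPerm : ∀ {n} → Vec (Fin n) n → Set
IsPerm π = Injective _≡_ _≡_ (app π)

-- π is cyclic: it is a permutation consisting of one n-cycle, i.e. the
-- orbit of 1 (here: fzero) under π is all of [n]
IsCyclic : ∀ {m} → Vec (Fin (suc m)) (suc m) → Set
IsCyclic {m} π = IsPerm π × (∀ (j : Fin (suc m)) → ∃ λ k → iter (app π) k fzero ≡ j)

-- standard cycle notation C(π) = (c_1, …, c_n), c_1 = 1, c_i = π(c_{i-1}),
-- i.e. c_{i+1} = π^i(1)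
cycleNotation : ∀ {m} → Vec (Fin (suc m)) (suc m) → Vec (Fin (suc m)) (suc m)
cycleNotation π = tabulate (λ i → iter (app π) (toℕ i) fzero)

Contains : ∀ {k m N} → Vec ℕ k → Vec (Fin N) m → Set
Contains {k} {m} σ w =
  Σ (Fin k → Fin m) λ ι →
    (∀ (a b : Fin k) → a <ᶠ b → ι a <ᶠ ι b) ×
    (∀ (a b : Fin k) → (lookup σ a < lookup σ b) ⇔ (toℕ (lookup w (ι a)) < toℕ (lookup w (ι b))))

Avoids : ∀ {k m N} → Vec ℕ k → Vec (Fin N) m → Set
Avoids σ w = ¬ Contains σ w

p312 : Vec ℕ 3
p312 = 3 ∷ 1 ∷ 2 ∷ []

p231 : Vec ℕ 3
p231 = 2 ∷ 3 ∷ 1 ∷ []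

-- membership in 𝒜_n(σ;τ), n = suc m
InA : ∀ {m} → Vec ℕ 3 → Vec ℕ 3 → Vec (Fin (suc m)) (suc m) → Set
InA σ τ π = IsCyclic π × Avoids σ π × Avoids τ (cycleNotation π)

HasCard : ∀ {A : Set} → (A → Set) → ℕ → Set
HasCard {A} P c = Σ (List A) λ L → Unique L × (∀ x → (x ∈ L) ⇔ P x) × (length L ≡ c)

-- ∑_{k=0}^{⌊(n-1)/3⌋} binom(n-1-k, 2k), with n - 1 = m
rhs : ℕ → ℕ
rhs m = sum (map (λ k → (m ∸ k) C (2 * k)) (upTo (suc (m / 3))))

-- Follow a cyclic permutation π of {0, …, m} (n = m + 1) along its cycle c 0 = 0, c 1, …, c m.
-- If π avoids 312 and its cycle avoids 231, the cycle is a concatenation of blocks: whenever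
-- c 0, …, c v exhaust {0, …, v}, either c (v + 1) = v + 1, or, with k = c (v + 1) > v + 1, the
-- cycle continues by the zigzag k, v + 1, k − 1, v + 2, … through (v, k] and c (k + 1) = k + 1.
-- Any deviation from this shape produces a 312 in π or a 231 in the cycle, and conversely every
-- such concatenation avoids both patterns. The block sizes, 1 or at least 3, form a composition
-- of m (the cycle ends with m), and compositions of m into such parts satisfy the recurrences
-- of ∑ₖ binom(m − k, 2k).

module Submission where

open import Defs
open import Data.Empty using (⊥; ⊥-elim)
open import Data.Fin using (Fin; toℕ; fromℕ<) renaming (zero to fzero; suc to fsuc; _<_ to _<ᶠ_)
open import Data.Fin.Properties using (toℕ-injective; toℕ-fromℕ<; toℕ<n; pigeonhole)
open import Data.List using (List; []; _∷_; map; length; _++_; applyUpTo)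
open import Data.List.Membership.Propositional using (_∈_)
open import Data.List.Membership.Propositional.Properties using (∈-map⁺; ∈-map⁻; ∈-++⁺ˡ; ∈-++⁺ʳ)
open import Data.List.Properties using (length-map; length-++; ∷-injectiveʳ; map-upTo)
open import Data.List.Relation.Unary.All as All using (All; []; _∷_)
import Data.List.Relation.Unary.All.Properties as All
open import Data.List.Relation.Unary.AllPairs using ([]; _∷_)
open import Data.List.Relation.Unary.Any using (here; there)
open import Data.List.Relation.Unary.Unique.Propositional using (Unique)
import Data.List.Relation.Unary.Unique.Propositional.Properties as Unique
open import Data.Nat
open import Data.Nat.Combinatorics using (_C_; nCk+nC[k+1]≡[n+1]C[k+1]; k>n⇒nCk≡0)
open import Data.Nat.DivMod using (_mod_; m≡m%n+[m/n]*n; m%n<n; m/n≤m; m≤n⇒m%n≡m)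
open import Data.Nat.ListAction using (sum)
open import Data.Nat.Properties
open import Algebra.Properties.CommutativeSemigroup +-commutativeSemigroup using (interchange)
open import Data.Nat.Tactic.RingSolver using (solve-∀)
open import Data.Product using (Σ-syntax; _×_; _,_; proj₁; proj₂)
open import Data.Sum using (_⊎_; inj₁; inj₂)
open import Data.Vec using (Vec; lookup; tabulate; _∷_; [])
open import Data.Vec.Properties using (lookup∘tabulate; tabulate∘lookup; tabulate-cong)
open import Function using (_∘_; _⇔_; mk⇔; Equivalence)
open import Function.Definitions using (Injective)
open import Relation.Binary.Definitions using (tri<; tri≈; tri>)
open import Relation.Binary.PropositionalEquality
open import Relation.Nullary using (yes; no; ¬_)


-- Sums of binomial coefficients

sumUpTo : (ℕ → ℕ) → ℕ → ℕ
sumUpTo f n = sum (applyUpTo f n)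

sumUpTo-cong : ∀ {f g} n → (∀ k → k < n → f k ≡ g k) → sumUpTo f n ≡ sumUpTo g n
sumUpTo-cong zero    f≗g = refl
sumUpTo-cong (suc n) f≗g =
  cong₂ _+_ (f≗g 0 z<s) (sumUpTo-cong n (λ k k<n → f≗g (suc k) (s<s k<n)))

sumUpTo-+ : ∀ f g n → sumUpTo (λ k → f k + g k) n ≡ sumUpTo f n + sumUpTo g n
sumUpTo-+ f g zero    = refl
sumUpTo-+ f g (suc n) =
  trans (cong ((f 0 + g 0) +_) (sumUpTo-+ (f ∘ suc) (g ∘ suc) n)) (interchange (f 0) (g 0) _ _)

sumUpTo-suc : ∀ f n → sumUpTo f (suc n) ≡ sumUpTo f n + f n
sumUpTo-suc f zero    = +-comm (f 0) 0
sumUpTo-suc f (suc n) = trans (cong (f 0 +_) (sumUpTo-suc (f ∘ suc) n)) (sym (+-assoc (f 0) _ _))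

sumUpTo-vanishing : ∀ f a b → (∀ k → a ≤ k → f k ≡ 0) → sumUpTo f (a + b) ≡ sumUpTo f a
sumUpTo-vanishing f zero    zero    f0 = refl
sumUpTo-vanishing f zero    (suc b) f0 =
  trans (cong (_+ sumUpTo (f ∘ suc) b) (f0 0 z≤n)) (sumUpTo-vanishing (f ∘ suc) 0 b (λ k _ → f0 (suc k) z≤n))
sumUpTo-vanishing f (suc a) b f0 =
  cong (f 0 +_) (sumUpTo-vanishing (f ∘ suc) a b (λ k a≤k → f0 (suc k) (s≤s a≤k)))

diagSum : ℕ → ℕ → ℕ
diagSum n e = sumUpTo (λ k → (n ∸ k) C (2 * k + e)) (suc n)

diagSum-pascal : ∀ n e → diagSum (suc n) (suc e) ≡ diagSum n (suc e) + diagSum n e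
diagSum-pascal n e = begin
  sumUpTo f (suc (suc n))                  ≡⟨ sumUpTo-suc f (suc n) ⟩
  sumUpTo f (suc n) + f (suc n)            ≡⟨ cong (sumUpTo f (suc n) +_) last≡0 ⟩
  sumUpTo f (suc n) + 0                    ≡⟨ +-identityʳ _ ⟩
  sumUpTo f (suc n)                        ≡⟨ sumUpTo-cong (suc n) pascal ⟩
  sumUpTo (λ k → g₁ k + g₀ k) (suc n)      ≡⟨ sumUpTo-+ g₁ g₀ (suc n) ⟩
  diagSum n (suc e) + diagSum n e          ∎
  where
  open ≡-Reasoning
  f g₁ g₀ : ℕ → ℕ
  f  k = (suc n ∸ k) C (2 * k + suc e)
  g₁ k = (n ∸ k) C (2 * k + suc e)
  g₀ k = (n ∸ k) C (2 * k + e)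
  last≡0 : f (suc n) ≡ 0
  last≡0 = trans (cong (_C (2 * suc n + suc e)) (n∸n≡0 n)) (cong (0 C_) (+-suc (2 * suc n) e))
  pascal : ∀ k → k < suc n → f k ≡ g₁ k + g₀ k
  pascal k (s≤s k≤n) rewrite +-∸-assoc 1 k≤n | +-suc (2 * k) e =
    sym (trans (+-comm ((n ∸ k) C suc (2 * k + e)) _) (nCk+nC[k+1]≡[n+1]C[k+1] (n ∸ k) (2 * k + e)))

diagSum-shift : ∀ n → diagSum (suc n) 0 ≡ 1 + diagSum n 2
diagSum-shift n = cong (1 +_) (sumUpTo-cong (suc n) (λ k _ → cong ((n ∸ k) C_) (2[1+k]≡2k+2 k)))
  where
  2[1+k]≡2k+2 : ∀ k → 2 * suc k + 0 ≡ 2 * k + 2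
  2[1+k]≡2k+2 k rewrite +-identityʳ (2 * suc k) | *-suc 2 k = +-comm 2 (2 * k)

m<3[1+m/3] : ∀ m → m < 3 * suc (m / 3)
m<3[1+m/3] m = begin-strict
  m                  ≡⟨ m≡m%n+[m/n]*n m 3 ⟩
  m % 3 + m / 3 * 3  <⟨ +-monoˡ-< (m / 3 * 3) (m%n<n m 3) ⟩
  3 + m / 3 * 3      ≡⟨ cong (3 +_) (*-comm (m / 3) 3) ⟩
  3 + 3 * (m / 3)    ≡⟨ *-suc 3 (m / 3) ⟨
  3 * suc (m / 3)    ∎
  where open ≤-Reasoning

rhs≡diagSum : ∀ m → rhs m ≡ diagSum m 0
rhs≡diagSum m = begin
  rhs m                              ≡⟨ cong sum (map-upTo f (suc (m / 3))) ⟩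
  sumUpTo f (suc (m / 3))            ≡⟨ sumUpTo-vanishing f (suc (m / 3)) (m ∸ m / 3) f≡0 ⟨
  sumUpTo f (suc (m / 3) + (m ∸ m / 3)) ≡⟨ cong (sumUpTo f ∘ suc) (m+[n∸m]≡n (m/n≤m m 3)) ⟩
  sumUpTo f (suc m)                  ≡⟨ sumUpTo-cong (suc m) (λ k _ → cong ((m ∸ k) C_) (sym (+-identityʳ (2 * k)))) ⟩
  diagSum m 0                        ∎
  where
  open ≡-Reasoning
  f : ℕ → ℕ
  f k = (m ∸ k) C (2 * k)
  -- For k > m/3 we have m < 3k, i.e. m ∸ k < 2k.
  f≡0 : ∀ k → suc (m / 3) ≤ k → f k ≡ 0
  f≡0 k m/3<k = k>n⇒nCk≡0 (+-cancelʳ-< k (m ∸ k) (2 * k) m∸k+k<2k+k)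
    where
    m<3k : m < 2 * k + k
    m<3k = subst (m <_) (+-comm k (2 * k)) (<-≤-trans (m<3[1+m/3] m) (*-monoʳ-≤ 3 m/3<k))
    m∸k+k<2k+k : (m ∸ k) + k < 2 * k + k
    m∸k+k<2k+k with k ≤? m
    ... | yes k≤m = subst (_< 2 * k + k) (sym (m∸n+n≡m k≤m)) m<3k
    ... | no k≰m  = subst (_< 2 * k + k) (cong (_+ k) (sym (m≤n⇒m∸n≡0 (<⇒≤ (≰⇒> k≰m)))))
                      (m<n+m k (*-monoʳ-< 2 (≤-trans (s≤s z≤n) m/3<k)))

-- Compositions into parts 1 and ≥ 3

-- A part 2 would encode the same permutation as two parts 1.
data Part : ℕ → Set where
  one : Part 1
  big : ∀ {t} → 3 ≤ t → Part t

Part⇒0< : ∀ {t} → Part t → 0 < t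
Part⇒0< one           = z<s
Part⇒0< (big (s≤s _)) = z<s

IsComp : ℕ → List ℕ → Set
IsComp m ts = All Part ts × sum ts ≡ m

BigHead : List ℕ → Set
BigHead []      = ⊥
BigHead (t ∷ _) = 3 ≤ t

incHead : List ℕ → List ℕ
incHead []       = []
incHead (t ∷ ts) = suc t ∷ ts

-- bigComps m holds the compositions of m with first part ≥ 3; for m + 3 that
-- part is 3, or the first part of a composition of m + 2 raised by one.
mutual
  comps : ℕ → List (List ℕ)
  comps zero    = [] ∷ []
  comps (suc m) = map (1 ∷_) (comps m) ++ bigComps (suc m)

  bigComps : ℕ → List (List ℕ)
  bigComps (suc (suc (suc m))) = map incHead (bigComps (suc (suc m))) ++ map (3 ∷_) (comps m)
  bigComps _                   = []

incHead-sound : ∀ {m ts} → IsComp (2 + m) ts × BigHead ts → IsComp (3 + m) (incHead ts) × BigHead (incHead ts)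
incHead-sound {ts = _ ∷ _} ((_ ∷ parts , sum≡) , 3≤t) =
  (big (m≤n⇒m≤1+n 3≤t) ∷ parts , cong suc sum≡) , m≤n⇒m≤1+n 3≤t

mutual
  comps-sound : ∀ m → All (IsComp m) (comps m)
  comps-sound zero    = ([] , refl) ∷ []
  comps-sound (suc m) =
    All.++⁺ (All.map⁺ (All.map (λ (parts , sum≡) → one ∷ parts , cong suc sum≡) (comps-sound m)))
            (All.map proj₁ (bigComps-sound (suc m)))

  bigComps-sound : ∀ m → All (λ ts → IsComp m ts × BigHead ts) (bigComps m)
  bigComps-sound (suc (suc (suc m))) =
    All.++⁺ (All.map⁺ (All.map incHead-sound (bigComps-sound (suc (suc m)))))
            (All.map⁺ (All.map (λ (parts , sum≡) → (big ≤-refl ∷ parts , cong (3 +_) sum≡) , ≤-refl) (comps-sound m)))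
  bigComps-sound zero             = []
  bigComps-sound (suc zero)       = []
  bigComps-sound (suc (suc zero)) = []

mutual
  comps-complete : ∀ {ts} → All Part ts → ts ∈ comps (sum ts)
  comps-complete []                = here refl
  comps-complete (one ∷ parts)     = ∈-++⁺ˡ (∈-map⁺ (1 ∷_) (comps-complete parts))
  comps-complete {suc t ∷ ts} (big 3≤t ∷ parts) =
    ∈-++⁺ʳ (map (1 ∷_) (comps (t + sum ts))) (bigComps-complete 3≤t parts)

  bigComps-complete : ∀ {t ts} → 3 ≤ t → All Part ts → (t ∷ ts) ∈ bigComps (t + sum ts)
  bigComps-complete {3} {ts} _ parts =
    ∈-++⁺ʳ (map incHead (bigComps (2 + sum ts))) (∈-map⁺ (3 ∷_) (comps-complete parts))
  bigComps-complete {suc (suc (suc (suc t)))} _ parts =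
    ∈-++⁺ˡ (∈-map⁺ incHead (bigComps-complete {suc (suc (suc t))} (s≤s (s≤s (s≤s z≤n))) parts))
  bigComps-complete {1} (s≤s ())       _
  bigComps-complete {2} (s≤s (s≤s ())) _

incHead-injective : ∀ {xs ys} → incHead xs ≡ incHead ys → xs ≡ ys
incHead-injective {[]}    {[]}     _    = refl
incHead-injective {_ ∷ _} {_ ∷ _} refl = refl

mutual
  comps-unique : ∀ m → Unique (comps m)
  comps-unique zero    = [] ∷ []
  comps-unique (suc m) =
    Unique.++⁺ (Unique.map⁺ ∷-injectiveʳ (comps-unique m)) (bigComps-unique (suc m)) disjoint
    where
    disjoint : ∀ {ts} → ts ∈ map (1 ∷_) (comps m) × ts ∈ bigComps (suc m) → ⊥
    disjoint (ts∈one , ts∈big) with ∈-map⁻ (1 ∷_) ts∈one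
    ... | _ , _ , refl with All.lookup (bigComps-sound (suc m)) ts∈big
    ...   | _ , s≤s ()

  bigComps-unique : ∀ m → Unique (bigComps m)
  bigComps-unique (suc (suc (suc m))) =
    Unique.++⁺ (Unique.map⁺ incHead-injective (bigComps-unique (suc (suc m))))
               (Unique.map⁺ ∷-injectiveʳ (comps-unique m)) disjoint
    where
    disjoint : ∀ {ts} → ts ∈ map incHead (bigComps (2 + m)) × ts ∈ map (3 ∷_) (comps m) → ⊥
    disjoint (ts∈inc , ts∈three) with ∈-map⁻ incHead ts∈inc | ∈-map⁻ (3 ∷_) ts∈three
    ... | us , us∈ , refl | _ , _ , 3∷≡ with us | All.lookup (bigComps-sound (2 + m)) us∈
    ...   | _ ∷ _ | _ , s≤s (s≤s (s≤s 1≤t)) with 3∷≡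
    ...     | ()
  bigComps-unique zero                = []
  bigComps-unique (suc zero)          = []
  bigComps-unique (suc (suc zero))    = []

length-comps-suc : ∀ m → length (comps (suc m)) ≡ length (comps m) + length (bigComps (suc m))
length-comps-suc m =
  trans (length-++ (map (1 ∷_) (comps m))) (cong (_+ length (bigComps (suc m))) (length-map (1 ∷_) (comps m)))

length-bigComps-sss : ∀ m → length (bigComps (3 + m)) ≡ length (bigComps (2 + m)) + length (comps m)
length-bigComps-sss m =
  trans (length-++ (map incHead (bigComps (2 + m))))
        (cong₂ _+_ (length-map incHead (bigComps (2 + m))) (length-map (3 ∷_) (comps m)))

length-comps&bigComps : ∀ m → length (comps m) ≡ diagSum m 0 × length (bigComps (2 + m)) ≡ diagSum m 1
length-comps&bigComps zero          = refl , refl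
length-comps&bigComps (suc zero)    = refl , refl
length-comps&bigComps (suc (suc m)) with length-comps&bigComps m | length-comps&bigComps (suc m)
... | comps₀ , big₀ | comps₁ , big₁ = comps₂ , big₂
  where
  open ≡-Reasoning
  comps₂ : length (comps (2 + m)) ≡ diagSum (2 + m) 0
  comps₂ = begin
    length (comps (2 + m))                            ≡⟨ length-comps-suc (1 + m) ⟩
    length (comps (1 + m)) + length (bigComps (2 + m)) ≡⟨ cong₂ _+_ comps₁ big₀ ⟩
    diagSum (1 + m) 0 + diagSum m 1                   ≡⟨ cong (_+ diagSum m 1) (diagSum-shift m) ⟩
    suc (diagSum m 2 + diagSum m 1)                   ≡⟨ cong suc (diagSum-pascal m 1) ⟨
    suc (diagSum (1 + m) 2)                           ≡⟨ diagSum-shift (1 + m) ⟨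
    diagSum (2 + m) 0                                 ∎
  big₂ : length (bigComps (4 + m)) ≡ diagSum (2 + m) 1
  big₂ = begin
    length (bigComps (4 + m))                          ≡⟨ length-bigComps-sss (1 + m) ⟩
    length (bigComps (3 + m)) + length (comps (1 + m)) ≡⟨ cong₂ _+_ big₁ comps₁ ⟩
    diagSum (1 + m) 1 + diagSum (1 + m) 0              ≡⟨ diagSum-pascal (1 + m) 0 ⟨
    diagSum (2 + m) 1                                  ∎

length-comps : ∀ m → length (comps m) ≡ diagSum m 0
length-comps m = proj₁ (length-comps&bigComps m)

-- Zigzag blocks

ifLt : {A : Set} → ℕ → ℕ → A → A → A
ifLt x       zero    a b = b
ifLt zero    (suc y) a b = a
ifLt (suc x) (suc y) a b = ifLt x y a b

ifLt-< : ∀ {A : Set} {x y} {a b : A} → x < y → ifLt x y a b ≡ a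
ifLt-< {x = zero}  {suc y} _         = refl
ifLt-< {x = suc x} {suc y} (s≤s x<y) = ifLt-< {x = x} x<y

ifLt-≥ : ∀ {A : Set} {x y} {a b : A} → y ≤ x → ifLt x y a b ≡ b
ifLt-≥ {x = x}     {zero}  _         = refl
ifLt-≥ {x = suc x} {suc y} (s≤s y≤x) = ifLt-≥ {x = x} y≤x

-- zigzag lo n lists [lo, lo + n) as lo + n − 1, lo, lo + n − 2, lo + 1, …;
-- its values at j ≥ n are junk.
zigzag : ℕ → ℕ → ℕ → ℕ
zigzag lo zero          j             = 0
zigzag lo (suc n)       zero          = lo + n
zigzag lo (suc n)       (suc zero)    = lo
zigzag lo (suc zero)    (suc (suc j)) = 0
zigzag lo (suc (suc n)) (suc (suc j)) = zigzag (suc lo) n j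

zigzag-range : ∀ lo n j → j < n → lo ≤ zigzag lo n j × zigzag lo n j < lo + n
zigzag-range lo (suc n) zero          _ = m≤m+n lo n , +-monoʳ-< lo (n<1+n n)
zigzag-range lo (suc n) (suc zero)    _ = ≤-refl , m<m+n lo z<s
zigzag-range lo (suc (suc n)) (suc (suc j)) (s≤s (s≤s j<n))
  with zigzag-range (suc lo) n j j<n
... | lo<z , z<1+lo+n = <⇒≤ lo<z , <-trans z<1+lo+n (subst (_< lo + suc (suc n)) (+-suc lo n) (+-monoʳ-< lo (n<1+n (suc n))))

zigzag-cover : ∀ lo n y → lo ≤ y → y < lo + n → Σ[ j ∈ ℕ ] j < n × zigzag lo n j ≡ y
zigzag-cover lo zero    y lo≤y y<lo+0 = ⊥-elim (<⇒≱ (subst (y <_) (+-identityʳ lo) y<lo+0) lo≤y)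
zigzag-cover lo (suc n) y lo≤y y<top+1 with y ≟ lo + n
... | yes refl = 0 , z<s , refl
... | no y≢top with y ≟ lo | n
...   | yes refl | zero   = ⊥-elim (y≢top (sym (+-identityʳ y)))
...   | yes refl | suc _  = 1 , s<s z<s , refl
...   | no y≢lo  | zero   = ⊥-elim (y≢lo (≤-antisym (m<1+n⇒m≤n (subst (y <_) (+-comm lo 1) y<top+1)) lo≤y))
...   | no y≢lo  | suc n′ with zigzag-cover (suc lo) n′ y (≤∧≢⇒< lo≤y (λ lo≡y → y≢lo (sym lo≡y))) y<1+lo+n′
  where
  y<1+lo+n′ : y < suc lo + n′
  y<1+lo+n′ = subst (y <_) (+-suc lo n′)
    (≤∧≢⇒< (m<1+n⇒m≤n (subst (y <_) (+-suc lo (suc n′)) y<top+1)) y≢top)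
...     | j , j<n′ , refl = suc (suc j) , s<s (s<s j<n′) , refl

zigzag-below-top : ∀ lo n j → 0 < j → j < suc n → zigzag lo (suc n) j < lo + n
zigzag-below-top lo zero    (suc zero)    _ (s<s ())
zigzag-below-top lo (suc n) (suc zero)    _ _ = m<m+n lo z<s
zigzag-below-top lo (suc (suc n)) (suc (suc j)) _ (s<s (s<s j<n)) =
  subst (zigzag (suc lo) (suc n) j <_) (sym (+-suc lo (suc n))) (proj₂ (zigzag-range (suc lo) (suc n) j j<n))

zigzag-injective : ∀ lo n i j → i < n → j < n → zigzag lo n i ≡ zigzag lo n j → i ≡ j
zigzag-injective lo (suc n) zero    zero    _ _ _ = refl
zigzag-injective lo (suc n) zero    (suc j) _ j<n eq =
  ⊥-elim (<-irrefl (sym eq) (zigzag-below-top lo n (suc j) z<s j<n))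
zigzag-injective lo (suc n) (suc i) zero    i<n _ eq =
  ⊥-elim (<-irrefl eq (zigzag-below-top lo n (suc i) z<s i<n))
zigzag-injective lo (suc n) (suc zero) (suc zero) _ _ _ = refl
zigzag-injective lo (suc (suc n)) (suc zero) (suc (suc j)) _ (s<s (s<s j<n)) eq =
  ⊥-elim (<-irrefl eq (proj₁ (zigzag-range (suc lo) n j j<n)))
zigzag-injective lo (suc (suc n)) (suc (suc i)) (suc zero) (s<s (s<s i<n)) _ eq =
  ⊥-elim (<-irrefl (sym eq) (proj₁ (zigzag-range (suc lo) n i i<n)))
zigzag-injective lo (suc (suc n)) (suc (suc i)) (suc (suc j)) (s<s (s<s i<n)) (s<s (s<s j<n)) eq =
  cong (suc ∘ suc) (zigzag-injective (suc lo) n i j i<n j<n eq)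

Pattern231 : (ℕ → ℕ) → ℕ → ℕ → ℕ → Set
Pattern231 f i j l = i < j × j < l × f l < f i × f i < f j

Pattern312 : (ℕ → ℕ) → ℕ → ℕ → ℕ → Set
Pattern312 f x y w = x < y × y < w × f y < f w × f w < f x

Pattern312-cong : ∀ {f g x y z} → (∀ k → k ≤ z → f k ≡ g k) → Pattern312 f x y z → Pattern312 g x y z
Pattern312-cong {x = x} {y} {z} f≗g (x<y , y<z , fʸ<fᶻ , fᶻ<fˣ) =
  x<y , y<z , subst₂ _<_ (f≗g y (<⇒≤ y<z)) (f≗g z ≤-refl) fʸ<fᶻ ,
              subst₂ _<_ (f≗g z ≤-refl) (f≗g x (<⇒≤ (<-trans x<y y<z))) fᶻ<fˣ

Pattern231-cong : ∀ {f g i j l} → (∀ k → k ≤ l → f k ≡ g k) → Pattern231 f i j l → Pattern231 g i j l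
Pattern231-cong {i = i} {j} {l} f≗g (i<j , j<l , fˡ<fⁱ , fⁱ<fʲ) =
  i<j , j<l , subst₂ _<_ (f≗g l ≤-refl) (f≗g i (<⇒≤ (<-trans i<j j<l))) fˡ<fⁱ ,
              subst₂ _<_ (f≗g i (<⇒≤ (<-trans i<j j<l))) (f≗g j (<⇒≤ j<l)) fⁱ<fʲ

zigzag-avoids231 : ∀ lo n i j l → l < n → ¬ Pattern231 (zigzag lo n) i j l
zigzag-avoids231 lo (suc n) zero j l l<n (_ , j<l , _ , top<zⱼ) =
  <⇒≱ top<zⱼ (m<1+n⇒m≤n (subst (zigzag lo (suc n) j <_) (+-suc lo n) (proj₂ (zigzag-range lo (suc n) j (<-trans j<l l<n)))))
zigzag-avoids231 lo (suc n) (suc zero) j l l<n (_ , _ , zₗ<lo , _) =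
  <⇒≱ zₗ<lo (proj₁ (zigzag-range lo (suc n) l l<n))
zigzag-avoids231 lo (suc (suc n)) (suc (suc i)) (suc (suc j)) (suc (suc l)) (s<s (s<s l<n))
  (s<s (s<s i<j) , s<s (s<s j<l) , zₗ<zᵢ , zᵢ<zⱼ) =
  zigzag-avoids231 (suc lo) n i j l l<n (i<j , j<l , zₗ<zᵢ , zᵢ<zⱼ)
zigzag-avoids231 lo (suc zero) (suc (suc i)) j l l<1 (i<j , j<l , _) =
  <⇒≱ (<-trans (<-trans i<j j<l) l<1) (s≤s z≤n)

zigzagSucc : ℕ → ℕ → ℕ → ℕ → ℕ
zigzagSucc B mid e x = ifLt x mid (B ∸ x) (ifLt x (suc mid) e (suc B ∸ x))

module _ {B mid e : ℕ} where

  zigzagSucc-< : ∀ {x} → x < mid → zigzagSucc B mid e x ≡ B ∸ x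
  zigzagSucc-< = ifLt-<

  zigzagSucc-mid : ∀ {x} → x ≡ mid → zigzagSucc B mid e x ≡ e
  zigzagSucc-mid refl = trans (ifLt-≥ {x = mid} ≤-refl) (ifLt-< {x = mid} ≤-refl)

  zigzagSucc-> : ∀ {x} → mid < x → zigzagSucc B mid e x ≡ suc B ∸ x
  zigzagSucc-> mid<x = trans (ifLt-≥ (<⇒≤ mid<x)) (ifLt-≥ mid<x)

private
  shift-lo : ∀ lo n → lo + lo + suc (suc n) ≡ suc lo + suc lo + n
  shift-lo = solve-∀

-- With B + 1 = 2 lo + n and mid = lo + ⌊ n / 2 ⌋, zigzagSucc walks along
-- zigzag lo (n + 1) and leaves it through e at its last entry (which is mid).
zigzagSucc-step : ∀ {B mid e} lo n j → suc B ≡ lo + lo + n → mid ≡ lo + ⌊ n /2⌋ → j < n →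
                  zigzagSucc B mid e (zigzag lo (suc n) j) ≡ zigzag lo (suc n) (suc j)
zigzagSucc-step {B} {mid} {e} lo (suc n) zero 1+B≡ refl _ = begin
  zigzagSucc B mid e (lo + suc n)  ≡⟨ zigzagSucc-> (+-monoʳ-< lo (⌊n/2⌋<n n)) ⟩
  suc B ∸ (lo + suc n)             ≡⟨ cong (_∸ (lo + suc n)) (trans 1+B≡ (+-assoc lo lo (suc n))) ⟩
  lo + (lo + suc n) ∸ (lo + suc n) ≡⟨ m+n∸n≡m lo (lo + suc n) ⟩
  lo                               ∎
  where open ≡-Reasoning
zigzagSucc-step {B} {mid} {e} lo (suc (suc n)) (suc zero) 1+B≡ refl _ = begin
  zigzagSucc B mid e lo  ≡⟨ zigzagSucc-< (m<m+n lo z<s) ⟩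
  B ∸ lo                 ≡⟨ cong (_∸ lo) B≡ ⟩
  lo + (lo + suc n) ∸ lo ≡⟨ m+n∸m≡n lo (lo + suc n) ⟩
  lo + suc n             ≡⟨ +-suc lo n ⟩
  suc lo + n             ∎
  where
  open ≡-Reasoning
  B≡ : B ≡ lo + (lo + suc n)
  B≡ = suc-injective (trans 1+B≡ (trans (+-suc (lo + lo) (suc n)) (cong suc (+-assoc lo lo (suc n)))))
zigzagSucc-step lo (suc zero) (suc zero) _ _ (s<s ())
zigzagSucc-step lo (suc (suc n)) (suc (suc j)) 1+B≡ mid≡ (s<s (s<s j<n)) =
  zigzagSucc-step (suc lo) n j (trans 1+B≡ (shift-lo lo n)) (trans mid≡ (+-suc lo ⌊ n /2⌋)) j<n

zigzagSucc-last : ∀ {B mid e} lo n → suc B ≡ lo + lo + n → mid ≡ lo + ⌊ n /2⌋ →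
                  zigzagSucc B mid e (zigzag lo (suc n) n) ≡ e
zigzagSucc-last lo zero       _ mid≡ = zigzagSucc-mid (sym mid≡)
zigzagSucc-last lo (suc zero) _ mid≡ = zigzagSucc-mid (sym (trans mid≡ (+-identityʳ lo)))
zigzagSucc-last lo (suc (suc n)) 1+B≡ mid≡ =
  zigzagSucc-last (suc lo) n (trans 1+B≡ (shift-lo lo n)) (trans mid≡ (+-suc lo ⌊ n /2⌋))

blockPerm : ℕ → ℕ → ℕ → ℕ
blockPerm v t = zigzagSucc (v + v + pred t) (v + ⌊ t /2⌋) (v + t)

blockCycle : ℕ → ℕ → ℕ → ℕ
blockCycle v t i = ifLt i (suc v) v (zigzag (suc v) (pred t) (i ∸ suc v))

-- A composition ts of m encodes, with v = 0, the cyclic permutation of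
-- {0, …, m} whose cycle notation is the concatenation of the blocks
-- v, zigzag (v + 1) (t − 1) of its parts t, followed by m; m is sent back to 0.
oneLine : List ℕ → ℕ → ℕ → ℕ
oneLine []       v x = 0
oneLine (t ∷ ts) v x = ifLt x (v + t) (blockPerm v t x) (oneLine ts (v + t) x)

cycleWord : List ℕ → ℕ → ℕ → ℕ
cycleWord []       v i = i
cycleWord (t ∷ ts) v i = ifLt i (v + t) (blockCycle v t i) (cycleWord ts (v + t) i)

Positive : List ℕ → Set
Positive = All (0 <_)

module _ {t : ℕ} (ts : List ℕ) (v : ℕ) where

  oneLine-inBlock : ∀ {x} → x < v + t → oneLine (t ∷ ts) v x ≡ blockPerm v t x
  oneLine-inBlock = ifLt-<

  oneLine-skip : ∀ {x} → v + t ≤ x → oneLine (t ∷ ts) v x ≡ oneLine ts (v + t) x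
  oneLine-skip = ifLt-≥

  cycleWord-skip : ∀ {i} → v + t ≤ i → cycleWord (t ∷ ts) v i ≡ cycleWord ts (v + t) i
  cycleWord-skip = ifLt-≥

  cycleWord-inBlock : ∀ j → suc v + j < v + t → cycleWord (t ∷ ts) v (suc v + j) ≡ zigzag (suc v) (pred t) j
  cycleWord-inBlock j i<v+t = begin
    cycleWord (t ∷ ts) v (suc v + j)                    ≡⟨ ifLt-< i<v+t ⟩
    blockCycle v t (suc v + j)                          ≡⟨ ifLt-≥ (m≤m+n (suc v) j) ⟩
    zigzag (suc v) (pred t) (suc v + j ∸ suc v)         ≡⟨ cong (zigzag (suc v) (pred t)) (m+n∸m≡n (suc v) j) ⟩
    zigzag (suc v) (pred t) j                           ∎
    where open ≡-Reasoning

cycleWord-start : ∀ {t} ts v → 0 < t → cycleWord (t ∷ ts) v v ≡ v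
cycleWord-start ts v 0<t = trans (ifLt-< (m<m+n v 0<t)) (ifLt-< {x = v} (n<1+n v))

cycleWord-end : ∀ ts v → cycleWord ts v (v + sum ts) ≡ v + sum ts
cycleWord-end []       v = refl
cycleWord-end (t ∷ ts) v rewrite sym (+-assoc v t (sum ts)) =
  trans (cycleWord-skip ts v (m≤m+n (v + t) (sum ts))) (cycleWord-end ts (v + t))

oneLine-end : ∀ ts v → oneLine ts v (v + sum ts) ≡ 0
oneLine-end []       v = refl
oneLine-end (t ∷ ts) v rewrite sym (+-assoc v t (sum ts)) =
  trans (oneLine-skip ts v (m≤m+n (v + t) (sum ts))) (oneLine-end ts (v + t))

data InBlock (v t : ℕ) : ℕ → Set where
  start : InBlock v t v
  inner : ∀ j → j < pred t → InBlock v t (suc v + j)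

inBlock : ∀ {v t i} → v ≤ i → i < v + t → InBlock v t i
inBlock {v} {zero}  {i} v≤i i<v+0 = ⊥-elim (<⇒≱ (subst (i <_) (+-identityʳ v) i<v+0) v≤i)
inBlock {v} {suc t} {i} v≤i i<v+t with i ≟ v
... | yes refl = start
... | no i≢v   = subst (InBlock v (suc t)) (m+[n∸m]≡n v<i) (inner (i ∸ suc v) (+-cancelˡ-< (suc v) _ _ j<t))
  where
  v<i : v < i
  v<i = ≤∧≢⇒< v≤i (i≢v ∘ sym)
  j<t : suc v + (i ∸ suc v) < suc v + t
  j<t = subst₂ _<_ (sym (m+[n∸m]≡n v<i)) (+-suc v t) i<v+t

1+v+pred[t]≡v+t : ∀ v {t} → 0 < t → suc v + pred t ≡ v + t
1+v+pred[t]≡v+t v {suc t} _ = sym (+-suc v t)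

inner-< : ∀ {v t} j → 0 < t → j < pred t → suc v + j < v + t
inner-< {v} j 0<t j<t = subst (suc v + j <_) (1+v+pred[t]≡v+t v 0<t) (+-monoʳ-< (suc v) j<t)

cycleWord-inFirst : ∀ {t} ts v {i} → 0 < t → v ≤ i → i < v + t → v ≤ cycleWord (t ∷ ts) v i × cycleWord (t ∷ ts) v i < v + t
cycleWord-inFirst {t} ts v 0<t v≤i i<v+t with inBlock v≤i i<v+t
... | start rewrite cycleWord-start ts v 0<t = ≤-refl , m<m+n v 0<t
... | inner j j<t rewrite cycleWord-inBlock ts v j (inner-< j 0<t j<t) =
  let v<z , z<hi = zigzag-range (suc v) (pred t) j j<t
  in  <⇒≤ v<z , subst (zigzag (suc v) (pred t) j <_) (1+v+pred[t]≡v+t v 0<t) z<hi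

cycleWord-≥ : ∀ {ts} v {i} → Positive ts → v ≤ i → v ≤ cycleWord ts v i
cycleWord-≥ v []                   v≤i = v≤i
cycleWord-≥ {t ∷ ts} v {i} (0<t ∷ pos) v≤i with i <? v + t
... | yes i<v+t = proj₁ (cycleWord-inFirst ts v 0<t v≤i i<v+t)
... | no  i≮v+t rewrite cycleWord-skip ts v (≮⇒≥ i≮v+t) =
  ≤-trans (m≤m+n v t) (cycleWord-≥ (v + t) pos (≮⇒≥ i≮v+t))

cycleWord-beyond : ∀ {t ts} v {i} → Positive ts → v + t ≤ i → v + t ≤ cycleWord (t ∷ ts) v i
cycleWord-beyond {ts = ts} v pos v+t≤i rewrite cycleWord-skip ts v v+t≤i = cycleWord-≥ _ pos v+t≤i

cycleWord-≤ : ∀ {ts} v {i} → Positive ts → v ≤ i → i ≤ v + sum ts → cycleWord ts v i ≤ v + sum ts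
cycleWord-≤ v [] _ i≤v+0 = i≤v+0
cycleWord-≤ {t ∷ ts} v {i} (0<t ∷ pos) v≤i i≤end with i <? v + t
... | yes i<v+t = ≤-trans (<⇒≤ (proj₂ (cycleWord-inFirst ts v 0<t v≤i i<v+t))) (+-monoʳ-≤ v (m≤m+n t (sum ts)))
... | no  i≮v+t rewrite cycleWord-skip ts v (≮⇒≥ i≮v+t) | sym (+-assoc v t (sum ts)) =
  cycleWord-≤ (v + t) pos (≮⇒≥ i≮v+t) i≤end

cycleWord-cover : ∀ {ts} v {y} → Positive ts → v ≤ y → y ≤ v + sum ts →
                  Σ[ i ∈ ℕ ] v ≤ i × i ≤ v + sum ts × cycleWord ts v i ≡ y
cycleWord-cover v {y} [] v≤y y≤v+0 = y , v≤y , y≤v+0 , refl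
cycleWord-cover {t ∷ ts} v {y} (0<t ∷ pos) v≤y y≤end with y <? v + t
... | no y≮v+t with cycleWord-cover (v + t) pos (≮⇒≥ y≮v+t) (subst (y ≤_) (sym (+-assoc v t (sum ts))) y≤end)
...   | i , v+t≤i , i≤end , refl =
  i , ≤-trans (m≤m+n v t) v+t≤i , subst (i ≤_) (+-assoc v t (sum ts)) i≤end , cycleWord-skip ts v v+t≤i
cycleWord-cover {t ∷ ts} v {y} (0<t ∷ pos) v≤y y≤end | yes y<v+t with y ≟ v
... | yes refl = y , ≤-refl , m≤m+n y _ , cycleWord-start ts y 0<t
... | no  y≢v with zigzag-cover (suc v) (pred t) y (≤∧≢⇒< v≤y (y≢v ∘ sym)) (subst (y <_) (sym (1+v+pred[t]≡v+t v 0<t)) y<v+t)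
...   | j , j<t , refl =
  suc v + j , m≤n⇒m≤1+n (m≤m+n v j) , ≤-trans (<⇒≤ i<v+t) (+-monoʳ-≤ v (m≤m+n t (sum ts))) , cycleWord-inBlock ts v j i<v+t
  where
  i<v+t : suc v + j < v + t
  i<v+t = inner-< j 0<t j<t

cycleWord-injective : ∀ {ts} v {i j} → Positive ts → v ≤ i → v ≤ j → i ≤ v + sum ts → j ≤ v + sum ts →
                      cycleWord ts v i ≡ cycleWord ts v j → i ≡ j
cycleWord-injective v [] _ _ _ _ eq = eq
cycleWord-injective {t ∷ ts} v {i} {j} (0<t ∷ pos) v≤i v≤j i≤end j≤end eq with i <? v + t | j <? v + t
... | no i≮ | no j≮ rewrite cycleWord-skip ts v (≮⇒≥ i≮) | cycleWord-skip ts v (≮⇒≥ j≮) | sym (+-assoc v t (sum ts)) =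
  cycleWord-injective (v + t) pos (≮⇒≥ i≮) (≮⇒≥ j≮) i≤end j≤end eq
... | yes i< | no j≮ = ⊥-elim (<⇒≱ (proj₂ (cycleWord-inFirst ts v 0<t v≤i i<)) (subst (v + t ≤_) (sym eq) (cycleWord-beyond v pos (≮⇒≥ j≮))))
... | no i≮ | yes j< = ⊥-elim (<⇒≱ (proj₂ (cycleWord-inFirst ts v 0<t v≤j j<)) (subst (v + t ≤_) eq (cycleWord-beyond v pos (≮⇒≥ i≮))))
... | yes i< | yes j< = inFirstBlock (inBlock v≤i i<) (inBlock v≤j j<) eq
  where
  inFirstBlock : ∀ {i j} → InBlock v t i → InBlock v t j → cycleWord (t ∷ ts) v i ≡ cycleWord (t ∷ ts) v j → i ≡ j
  inFirstBlock start start _ = refl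
  inFirstBlock start (inner j j<t) eq =
    ⊥-elim (<⇒≢ (proj₁ (zigzag-range (suc v) (pred t) j j<t))
                (trans (sym (cycleWord-start ts v 0<t)) (trans eq (cycleWord-inBlock ts v j (inner-< j 0<t j<t)))))
  inFirstBlock (inner i i<t) start eq =
    ⊥-elim (<⇒≢ (proj₁ (zigzag-range (suc v) (pred t) i i<t))
                (trans (sym (cycleWord-start ts v 0<t)) (trans (sym eq) (cycleWord-inBlock ts v i (inner-< i 0<t i<t)))))
  inFirstBlock (inner i i<t) (inner j j<t) eq = cong (suc v +_) (zigzag-injective (suc v) (pred t) i j i<t j<t
    (trans (sym (cycleWord-inBlock ts v i (inner-< i 0<t i<t))) (trans eq (cycleWord-inBlock ts v j (inner-< j 0<t j<t)))))

cycleWord-avoids231 : ∀ {ts} v {i j l} → Positive ts → v ≤ i → l ≤ v + sum ts → ¬ Pattern231 (cycleWord ts v) i j l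
cycleWord-avoids231 v [] v≤i l≤v+0 (i<j , j<l , _) =
  <⇒≱ (<-trans i<j j<l) (≤-trans (subst (_ ≤_) (+-identityʳ v) l≤v+0) v≤i)
cycleWord-avoids231 {t ∷ ts} v {i} {j} {l} (0<t ∷ pos) v≤i l≤end (i<j , j<l , wₗ<wᵢ , wᵢ<wⱼ) with i <? v + t
... | no i≮ rewrite cycleWord-skip ts v (≮⇒≥ i≮)
                  | cycleWord-skip ts v (≤-trans (≮⇒≥ i≮) (<⇒≤ i<j))
                  | cycleWord-skip ts v (≤-trans (≮⇒≥ i≮) (<⇒≤ (<-trans i<j j<l)))
                  | sym (+-assoc v t (sum ts)) =
  cycleWord-avoids231 (v + t) pos (≮⇒≥ i≮) l≤end (i<j , j<l , wₗ<wᵢ , wᵢ<wⱼ)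
... | yes i< with l <? v + t
...   | no l≮ = <⇒≱ wₗ<wᵢ (≤-trans (<⇒≤ (proj₂ (cycleWord-inFirst ts v 0<t v≤i i<))) (cycleWord-beyond v pos (≮⇒≥ l≮)))
...   | yes l< with inBlock v≤i i<
...     | start = <⇒≱ wₗ<wᵢ (subst (_≤ cycleWord (t ∷ ts) v l) (sym (cycleWord-start ts v 0<t))
                                    (cycleWord-≥ v (0<t ∷ pos) (<⇒≤ (<-trans i<j j<l))))
...     | inner i′ i′<t with inBlock (v≤inner i<j) (<-trans j<l l<) | inBlock (v≤inner (<-trans i<j j<l)) l<
  where
  v≤inner : ∀ {k} → suc v + i′ < k → v ≤ k
  v≤inner i<k = ≤-trans (m≤n⇒m≤1+n (m≤m+n v i′)) (<⇒≤ i<k)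
...       | start | _ = <⇒≱ i<j (m≤n⇒m≤1+n (m≤m+n v i′))
...       | inner _ _ | start = <⇒≱ (<-trans i<j j<l) (m≤n⇒m≤1+n (m≤m+n v i′))
...       | inner j′ j′<t | inner l′ l′<t
  rewrite cycleWord-inBlock ts v i′ (inner-< i′ 0<t i′<t)
        | cycleWord-inBlock ts v j′ (inner-< j′ 0<t j′<t)
        | cycleWord-inBlock ts v l′ (inner-< l′ 0<t l′<t) =
  zigzag-avoids231 (suc v) (pred t) i′ j′ l′ l′<t
    (+-cancelˡ-< (suc v) i′ j′ i<j , +-cancelˡ-< (suc v) j′ l′ j<l , wₗ<wᵢ , wᵢ<wⱼ)

private
  blockPerm-bound : ∀ v n → suc (v + v + suc n) ≡ suc v + suc v + n
  blockPerm-bound = solve-∀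

blockPerm-zigzag-step : ∀ v n {j} → j < n → blockPerm v (2 + n) (zigzag (suc v) (suc n) j) ≡ zigzag (suc v) (suc n) (suc j)
blockPerm-zigzag-step v n {j} = zigzagSucc-step (suc v) n j (blockPerm-bound v n) (+-suc v ⌊ n /2⌋)

blockPerm-zigzag-last : ∀ v n → blockPerm v (2 + n) (zigzag (suc v) (suc n) n) ≡ v + (2 + n)
blockPerm-zigzag-last v n = zigzagSucc-last (suc v) n (blockPerm-bound v n) (+-suc v ⌊ n /2⌋)

blockPerm-single : ∀ v → blockPerm v 1 v ≡ v + 1
blockPerm-single v = zigzagSucc-mid (sym (+-identityʳ v))

blockPerm-start : ∀ v n → blockPerm v (2 + n) v ≡ suc v + n
blockPerm-start v n = begin
  blockPerm v (2 + n) v  ≡⟨ zigzagSucc-< (m<m+n v z<s) ⟩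
  v + v + suc n ∸ v      ≡⟨ cong (_∸ v) (+-assoc v v (suc n)) ⟩
  v + (v + suc n) ∸ v    ≡⟨ m+n∸m≡n v (v + suc n) ⟩
  v + suc n              ≡⟨ +-suc v n ⟩
  suc v + n              ∎
  where open ≡-Reasoning

cycleWord-self : ∀ {ts} v → Positive ts → cycleWord ts v v ≡ v
cycleWord-self v []        = refl
cycleWord-self v (_∷_ {xs = ts} 0<t _) = cycleWord-start ts v 0<t

oneLine-cycleWord-start : ∀ {t ts} v → 0 < t → Positive ts → oneLine (t ∷ ts) v (cycleWord (t ∷ ts) v v) ≡ cycleWord (t ∷ ts) v (suc v)
oneLine-cycleWord-start {suc zero} {ts} v _ pos = begin
  oneLine (1 ∷ ts) v (cycleWord (1 ∷ ts) v v) ≡⟨ cong (oneLine (1 ∷ ts) v) (cycleWord-start ts v z<s) ⟩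
  oneLine (1 ∷ ts) v v                        ≡⟨ oneLine-inBlock ts v (m<m+n v z<s) ⟩
  blockPerm v 1 v                             ≡⟨ blockPerm-single v ⟩
  v + 1                                       ≡⟨ cycleWord-self (v + 1) pos ⟨
  cycleWord ts (v + 1) (v + 1)                ≡⟨ cong (cycleWord ts (v + 1)) (+-comm v 1) ⟩
  cycleWord ts (v + 1) (suc v)                ≡⟨ cycleWord-skip ts v (≤-reflexive (+-comm v 1)) ⟨
  cycleWord (1 ∷ ts) v (suc v)                ∎
  where open ≡-Reasoning
oneLine-cycleWord-start {suc (suc n)} {ts} v _ _ = begin
  oneLine (t ∷ ts) v (cycleWord (t ∷ ts) v v) ≡⟨ cong (oneLine (t ∷ ts) v) (cycleWord-start ts v z<s) ⟩
  oneLine (t ∷ ts) v v                        ≡⟨ oneLine-inBlock ts v (m<m+n v z<s) ⟩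
  blockPerm v t v                             ≡⟨ blockPerm-start v n ⟩
  zigzag (suc v) (suc n) 0                    ≡⟨ cycleWord-inBlock ts v 0 (inner-< 0 z<s (s≤s z≤n)) ⟨
  cycleWord (t ∷ ts) v (suc v + 0)            ≡⟨ cong (cycleWord (t ∷ ts) v) (+-identityʳ (suc v)) ⟩
  cycleWord (t ∷ ts) v (suc v)                ∎
  where
  open ≡-Reasoning
  t = suc (suc n)

oneLine-cycleWord-inner : ∀ {n ts} v {j} → Positive ts → j < suc n →
  oneLine (suc (suc n) ∷ ts) v (cycleWord (suc (suc n) ∷ ts) v (suc v + j)) ≡ cycleWord (suc (suc n) ∷ ts) v (suc (suc v + j))
oneLine-cycleWord-inner {n} {ts} v {j} pos j<t = begin
  oneLine (t ∷ ts) v (cycleWord (t ∷ ts) v (suc v + j)) ≡⟨ cong (oneLine (t ∷ ts) v) (cycleWord-inBlock ts v j (inner-< j z<s j<t)) ⟩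
  oneLine (t ∷ ts) v (zigzag (suc v) (suc n) j)          ≡⟨ oneLine-inBlock ts v z<v+t ⟩
  blockPerm v t (zigzag (suc v) (suc n) j)               ≡⟨ next ⟩
  cycleWord (t ∷ ts) v (suc (suc v + j))                 ∎
  where
  open ≡-Reasoning
  t = suc (suc n)
  z<v+t : zigzag (suc v) (suc n) j < v + t
  z<v+t = subst (zigzag (suc v) (suc n) j <_) (1+v+pred[t]≡v+t v z<s) (proj₂ (zigzag-range (suc v) (suc n) j j<t))
  next : blockPerm v t (zigzag (suc v) (suc n) j) ≡ cycleWord (t ∷ ts) v (suc (suc v + j))
  next with j <? n
  ... | yes j<n = begin
    blockPerm v t (zigzag (suc v) (suc n) j) ≡⟨ blockPerm-zigzag-step v n j<n ⟩
    zigzag (suc v) (suc n) (suc j)           ≡⟨ cycleWord-inBlock ts v (suc j) (inner-< (suc j) z<s (s≤s j<n)) ⟨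
    cycleWord (t ∷ ts) v (suc v + suc j)     ≡⟨ cong (cycleWord (t ∷ ts) v) (+-suc (suc v) j) ⟩
    cycleWord (t ∷ ts) v (suc (suc v + j))   ∎
  ... | no j≮n rewrite ≤-antisym (m<1+n⇒m≤n j<t) (≮⇒≥ j≮n) = begin
    blockPerm v t (zigzag (suc v) (suc n) n) ≡⟨ blockPerm-zigzag-last v n ⟩
    v + t                                    ≡⟨ cycleWord-self (v + t) pos ⟨
    cycleWord ts (v + t) (v + t)             ≡⟨ cycleWord-skip ts v ≤-refl ⟨
    cycleWord (t ∷ ts) v (v + t)             ≡⟨ cong (cycleWord (t ∷ ts) v) (trans (+-suc v (suc n)) (cong suc (+-suc v n))) ⟩
    cycleWord (t ∷ ts) v (suc (suc v + n))   ∎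

oneLine-cycleWord : ∀ {ts} v {i} → Positive ts → v ≤ i → i < v + sum ts →
                    oneLine ts v (cycleWord ts v i) ≡ cycleWord ts v (suc i)
oneLine-cycleWord v {i} [] v≤i i<v+0 = ⊥-elim (<⇒≱ (subst (i <_) (+-identityʳ v) i<v+0) v≤i)
oneLine-cycleWord {t ∷ ts} v {i} (0<t ∷ pos) v≤i i<end with i <? v + t
... | no i≮ = begin
  oneLine (t ∷ ts) v (cycleWord (t ∷ ts) v i)     ≡⟨ cong (oneLine (t ∷ ts) v) (cycleWord-skip ts v v+t≤i) ⟩
  oneLine (t ∷ ts) v (cycleWord ts (v + t) i)     ≡⟨ oneLine-skip ts v (cycleWord-≥ (v + t) pos v+t≤i) ⟩
  oneLine ts (v + t) (cycleWord ts (v + t) i)     ≡⟨ oneLine-cycleWord (v + t) pos v+t≤i (subst (i <_) (sym (+-assoc v t (sum ts))) i<end) ⟩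
  cycleWord ts (v + t) (suc i)                    ≡⟨ cycleWord-skip ts v (m≤n⇒m≤1+n v+t≤i) ⟨
  cycleWord (t ∷ ts) v (suc i)                    ∎
  where
  open ≡-Reasoning
  v+t≤i = ≮⇒≥ i≮
... | yes i< with inBlock v≤i i<
...   | start = oneLine-cycleWord-start v 0<t pos
...   | inner j j<t with t
...     | suc (suc n) = oneLine-cycleWord-inner v pos j<t

module _ (v : ℕ) {t : ℕ} (0<t : 0 < t) where

  private
    B mid : ℕ
    B   = v + v + pred t
    mid = v + ⌊ t /2⌋
    B∸v≡ : B ∸ v ≡ v + pred t
    B∸v≡ = trans (cong (_∸ v) (+-assoc v v (pred t))) (m+n∸m≡n v (v + pred t))
    1+B≡ : suc B ≡ v + v + t
    1+B≡ = trans (sym (+-suc (v + v) (pred t))) (cong (v + v +_) (suc-pred t {{>-nonZero 0<t}}))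

  blockPerm-≤ : ∀ {x} → v ≤ x → blockPerm v t x ≤ v + t
  blockPerm-≤ {x} v≤x with <-cmp x mid
  ... | tri< x<mid _ _ rewrite zigzagSucc-< {B} {e = v + t} x<mid =
    ≤-trans (∸-monoʳ-≤ B v≤x) (≤-trans (≤-reflexive B∸v≡) (+-monoʳ-≤ v pred[n]≤n))
  ... | tri≈ _ x≡mid _ rewrite zigzagSucc-mid {B} {mid} {v + t} x≡mid = ≤-refl
  ... | tri> _ _ mid<x rewrite zigzagSucc-> {B} {e = v + t} mid<x =
    ≤-trans (∸-monoʳ-≤ (suc B) v≤x) (≤-reflexive (trans (+-∸-assoc 1 (≤-trans (m≤m+n v v) (m≤m+n (v + v) _)))
                                                        (trans (cong suc B∸v≡) (1+v+pred[t]≡v+t v 0<t))))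

  blockPerm-> : ∀ {x} → x < v + t → v < blockPerm v t x
  blockPerm-> {x} x<v+t with <-cmp x mid
  ... | tri< x<mid _ _ rewrite zigzagSucc-< {B} {e = v + t} x<mid =
    m+n≤o⇒m≤o∸n (suc v) (subst (suc v + x ≤_) (sym (+-assoc v v (pred t)))
      (+-monoʳ-< v (<-≤-trans x<mid (+-monoʳ-≤ v (⌊n/2⌋≤pred t)))))
    where
    ⌊n/2⌋≤pred : ∀ t → ⌊ t /2⌋ ≤ pred t
    ⌊n/2⌋≤pred zero    = z≤n
    ⌊n/2⌋≤pred (suc t) = m<1+n⇒m≤n (⌊n/2⌋<n t)
  ... | tri≈ _ x≡mid _ rewrite zigzagSucc-mid {B} {mid} {v + t} x≡mid = m<m+n v 0<t
  ... | tri> _ _ mid<x rewrite zigzagSucc-> {B} {e = v + t} mid<x | 1+B≡ =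
    m+n≤o⇒m≤o∸n (suc v) (subst (suc v + x ≤_) (sym (+-assoc v v t)) (+-monoʳ-< v x<v+t))

  blockPerm-ascent : ∀ {x y} → v ≤ x → x < y → blockPerm v t x < blockPerm v t y → blockPerm v t y ≡ v + t
  blockPerm-ascent {x} {y} v≤x x<y asc with <-cmp y mid
  ... | tri≈ _ y≡mid _ = zigzagSucc-mid y≡mid
  ... | tri< y<mid _ _ rewrite zigzagSucc-< {B} {e = v + t} y<mid | zigzagSucc-< {B} {e = v + t} (<-trans x<y y<mid) =
    ⊥-elim (<⇒≱ asc (∸-monoʳ-≤ B (<⇒≤ x<y)))
  ... | tri> _ _ mid<y with <-cmp x mid
  ...   | tri< x<mid _ _ rewrite zigzagSucc-> {B} {e = v + t} mid<y | zigzagSucc-< {B} {e = v + t} x<mid =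
    ⊥-elim (<⇒≱ asc (∸-monoʳ-≤ (suc B) x<y))
  ...   | tri≈ _ x≡mid _ rewrite zigzagSucc-mid {B} {mid} {v + t} x≡mid =
    ⊥-elim (<⇒≱ asc (blockPerm-≤ (≤-trans v≤x (<⇒≤ x<y))))
  ...   | tri> _ _ mid<x rewrite zigzagSucc-> {B} {e = v + t} mid<y | zigzagSucc-> {B} {e = v + t} mid<x =
    ⊥-elim (<⇒≱ asc (∸-monoʳ-≤ (suc B) (<⇒≤ x<y)))

oneLine-range : ∀ {ts} v {x} → Positive ts → v ≤ x → x < v + sum ts → v < oneLine ts v x × oneLine ts v x ≤ v + sum ts
oneLine-range v {x} [] v≤x x<v+0 = ⊥-elim (<⇒≱ (subst (x <_) (+-identityʳ v) x<v+0) v≤x)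
oneLine-range {t ∷ ts} v {x} (0<t ∷ pos) v≤x x<end with x <? v + t
... | yes x< rewrite oneLine-inBlock ts v x< =
  blockPerm-> v 0<t x< , ≤-trans (blockPerm-≤ v 0<t v≤x) (+-monoʳ-≤ v (m≤m+n t (sum ts)))
... | no x≮ rewrite oneLine-skip ts v (≮⇒≥ x≮) | sym (+-assoc v t (sum ts)) =
  let v+t<p , p≤end = oneLine-range (v + t) pos (≮⇒≥ x≮) x<end
  in  <-trans (m<m+n v 0<t) v+t<p , p≤end

oneLine-avoids312 : ∀ {ts} v {x y w} → Positive ts → v ≤ x → w ≤ v + sum ts → ¬ Pattern312 (oneLine ts v) x y w
oneLine-avoids312 v {x} {y} {w} [] v≤x w≤v+0 (x<y , y<w , _) =
  <⇒≱ (<-trans x<y y<w) (≤-trans (subst (w ≤_) (+-identityʳ v) w≤v+0) v≤x)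
oneLine-avoids312 {t ∷ ts} v {x} {y} {w} (0<t ∷ pos) v≤x w≤end (x<y , y<w , pʸ<pʷ , pʷ<pˣ) with x <? v + t
... | no x≮ rewrite oneLine-skip ts v (≮⇒≥ x≮)
                  | oneLine-skip ts v (≤-trans (≮⇒≥ x≮) (<⇒≤ x<y))
                  | oneLine-skip ts v (≤-trans (≮⇒≥ x≮) (<⇒≤ (<-trans x<y y<w)))
                  | sym (+-assoc v t (sum ts)) =
  oneLine-avoids312 (v + t) pos (≮⇒≥ x≮) w≤end (x<y , y<w , pʸ<pʷ , pʷ<pˣ)
... | yes x< rewrite oneLine-inBlock ts v x< with w <? v + t
...   | yes w< rewrite oneLine-inBlock ts v (<-trans y<w w<) | oneLine-inBlock ts v w<
                     | blockPerm-ascent v 0<t (≤-trans v≤x (<⇒≤ x<y)) y<w pʸ<pʷ =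
  <⇒≱ pʷ<pˣ (blockPerm-≤ v 0<t v≤x)
...   | no w≮ rewrite oneLine-skip ts v (≮⇒≥ w≮) | sym (+-assoc v t (sum ts)) with w <? v + t + sum ts
...     | yes w<end = <⇒≱ pʷ<pˣ (≤-trans (blockPerm-≤ v 0<t v≤x) (<⇒≤ (proj₁ (oneLine-range (v + t) pos (≮⇒≥ w≮) w<end))))
...     | no w≮end rewrite ≤-antisym w≤end (≮⇒≥ w≮end) | oneLine-end ts (v + t) = <⇒≱ pʸ<pʷ z≤n

blockPerm-first : ∀ v {t} → 0 < t → blockPerm v t v ≡ suc v + (t ∸ 2)
blockPerm-first v {suc zero}    _ = trans (blockPerm-single v) (trans (+-comm v 1) (cong suc (sym (+-identityʳ v))))
blockPerm-first v {suc (suc n)} _ = blockPerm-start v n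

Part-∸2-injective : ∀ {t u} → Part t → Part u → t ∸ 2 ≡ u ∸ 2 → t ≡ u
Part-∸2-injective one one _ = refl
Part-∸2-injective one (big (s≤s (s≤s (s≤s _)))) ()
Part-∸2-injective (big (s≤s (s≤s (s≤s _)))) one ()
Part-∸2-injective (big (s≤s (s≤s (s≤s _)))) (big (s≤s (s≤s (s≤s _)))) eq = cong (2 +_) eq

oneLine-determines-parts : ∀ {ts us} v → All Part ts → All Part us → sum ts ≡ sum us →
                    (∀ x → v ≤ x → x < v + sum ts → oneLine ts v x ≡ oneLine us v x) → ts ≡ us
oneLine-determines-parts v [] [] _ _ = refl
oneLine-determines-parts v [] (p ∷ _) 0≡ _ = ⊥-elim (<⇒≢ (≤-trans (Part⇒0< p) (m≤m+n _ _)) 0≡)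
oneLine-determines-parts v (p ∷ _) [] ≡0 _ = ⊥-elim (<⇒≢ (≤-trans (Part⇒0< p) (m≤m+n _ _)) (sym ≡0))
oneLine-determines-parts {t ∷ ts} {u ∷ us} v (p ∷ ps) (q ∷ qs) sum≡ same with t≡u
  where
  firstValue : ∀ {t} ts → Part t → oneLine (t ∷ ts) v v ≡ suc v + (t ∸ 2)
  firstValue ts p = trans (oneLine-inBlock ts v (m<m+n v (Part⇒0< p))) (blockPerm-first v (Part⇒0< p))
  t≡u : t ≡ u
  t≡u = Part-∸2-injective p q (+-cancelˡ-≡ (suc v) _ _
          (trans (sym (firstValue ts p)) (trans (same v ≤-refl (m<m+n v (≤-trans (Part⇒0< p) (m≤m+n t (sum ts)))))
                 (firstValue us q))))
... | refl = cong (t ∷_) (oneLine-determines-parts (v + t) ps qs (+-cancelˡ-≡ t _ _ sum≡) sameRest)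
  where
  sameRest : ∀ x → v + t ≤ x → x < v + t + sum ts → oneLine ts (v + t) x ≡ oneLine us (v + t) x
  sameRest x v+t≤x x<end = begin
    oneLine ts (v + t) x       ≡⟨ oneLine-skip ts v v+t≤x ⟨
    oneLine (t ∷ ts) v x       ≡⟨ same x (≤-trans (m≤m+n v t) v+t≤x) (subst (x <_) (+-assoc v t (sum ts)) x<end) ⟩
    oneLine (t ∷ us) v x       ≡⟨ oneLine-skip us v v+t≤x ⟩
    oneLine us (v + t) x       ∎
    where open ≡-Reasoning

-- Pattern occurrences in vectors over Fin

-- Values above m are sent to their residue mod (m + 1), a junk value never used.
fin : ∀ {m} → ℕ → Fin (suc m)
fin {m} x = x mod suc m

toℕ-fin : ∀ {m x} → x ≤ m → toℕ (fin {m} x) ≡ x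
toℕ-fin {m} {x} x≤m = trans (toℕ-fromℕ< _) (m≤n⇒m%n≡m x≤m)

fin-toℕ : ∀ {m} (a : Fin (suc m)) → fin (toℕ a) ≡ a
fin-toℕ a = toℕ-injective (toℕ-fin (m<1+n⇒m≤n (toℕ<n a)))

module _ {k M N : ℕ} (σ : Vec ℕ k) (σ-injective : Injective _≡_ _≡_ (lookup σ)) (w : Vec (Fin N) M) where

  contains-intro : (ι : Fin k → Fin M) → (∀ a b → a <ᶠ b → ι a <ᶠ ι b) →
                   (∀ a b → lookup σ a < lookup σ b → toℕ (lookup w (ι a)) < toℕ (lookup w (ι b))) → Contains σ w
  contains-intro ι ι-mono ι-order = ι , ι-mono , λ a b → mk⇔ (ι-order a b) (reflect a b)
    where
    reflect : ∀ a b → toℕ (lookup w (ι a)) < toℕ (lookup w (ι b)) → lookup σ a < lookup σ b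
    reflect a b wᵃ<wᵇ with <-cmp (lookup σ a) (lookup σ b)
    ... | tri< σᵃ<σᵇ _ _ = σᵃ<σᵇ
    ... | tri≈ _ σᵃ≡σᵇ _ rewrite σ-injective σᵃ≡σᵇ = ⊥-elim (<-irrefl refl wᵃ<wᵇ)
    ... | tri> _ _ σᵇ<σᵃ = ⊥-elim (<-asym wᵃ<wᵇ (ι-order b a σᵇ<σᵃ))

module _ {m x y z : ℕ} (x<y : x < y) (y<z : y < z) (z≤m : z ≤ m) where

  triple : Fin 3 → Fin (suc m)
  triple a = fin (lookup (x ∷ y ∷ z ∷ []) a)

  toℕ-triple : ∀ a → toℕ (triple a) ≡ lookup (x ∷ y ∷ z ∷ []) a
  toℕ-triple fzero               = toℕ-fin (≤-trans (<⇒≤ (<-trans x<y y<z)) z≤m)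
  toℕ-triple (fsuc fzero)        = toℕ-fin (≤-trans (<⇒≤ y<z) z≤m)
  toℕ-triple (fsuc (fsuc fzero)) = toℕ-fin z≤m

  triple-mono : ∀ a b → a <ᶠ b → triple a <ᶠ triple b
  triple-mono a b a<b = subst₂ _<_ (sym (toℕ-triple a)) (sym (toℕ-triple b)) (ordered a b a<b)
    where
    ordered : ∀ a b → a <ᶠ b → lookup (x ∷ y ∷ z ∷ []) a < lookup (x ∷ y ∷ z ∷ []) b
    ordered fzero        (fsuc fzero)        _ = x<y
    ordered fzero        (fsuc (fsuc fzero)) _ = <-trans x<y y<z
    ordered (fsuc fzero) (fsuc (fsuc fzero)) _ = y<z
    ordered (fsuc _)        (fsuc fzero)        (s≤s ())
    ordered (fsuc (fsuc _)) (fsuc (fsuc fzero)) (s≤s (s≤s ()))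

p312-injective : Injective _≡_ _≡_ (lookup p312)
p312-injective {fzero}             {fzero}             _ = refl
p312-injective {fsuc fzero}        {fsuc fzero}        _ = refl
p312-injective {fsuc (fsuc fzero)} {fsuc (fsuc fzero)} _ = refl
p312-injective {fzero}             {fsuc fzero}        ()
p312-injective {fzero}             {fsuc (fsuc fzero)} ()
p312-injective {fsuc fzero}        {fsuc (fsuc fzero)} ()

p231-injective : Injective _≡_ _≡_ (lookup p231)
p231-injective {fzero}             {fzero}             _ = refl
p231-injective {fsuc fzero}        {fsuc fzero}        _ = refl
p231-injective {fsuc (fsuc fzero)} {fsuc (fsuc fzero)} _ = refl
p231-injective {fzero}             {fsuc fzero}        ()
p231-injective {fzero}             {fsuc (fsuc fzero)} ()
p231-injective {fsuc fzero}        {fsuc (fsuc fzero)} ()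

module _ {m N : ℕ} (w : Vec (Fin N) (suc m)) (f : ℕ → ℕ) (w≗f : ∀ a → toℕ (lookup w a) ≡ f (toℕ a)) where

  private
    f₀ f₁ f₂ : Fin 3
    f₀ = fzero
    f₁ = fsuc fzero
    f₂ = fsuc (fsuc fzero)

    occurrence-order : ∀ (σ : Vec ℕ 3) → ((ι , _) : Contains σ w) → ∀ a b → lookup σ a < lookup σ b → f (toℕ (ι a)) < f (toℕ (ι b))
    occurrence-order σ (ι , _ , iff) a b σᵃ<σᵇ = subst₂ _<_ (w≗f (ι a)) (w≗f (ι b)) (Equivalence.to (iff a b) σᵃ<σᵇ)

    occurrence-≤m : ∀ (σ : Vec ℕ 3) → ((ι , _) : Contains σ w) → toℕ (ι f₂) ≤ m
    occurrence-≤m σ (ι , _) = m<1+n⇒m≤n (toℕ<n (ι f₂))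

    triple-order : ∀ {x y z} (x<y : x < y) (y<z : y < z) (z≤m : z ≤ m) (σ : Vec ℕ 3) →
                   (∀ a b → lookup σ a < lookup σ b → f (lookup (x ∷ y ∷ z ∷ []) a) < f (lookup (x ∷ y ∷ z ∷ []) b)) →
                   ∀ a b → lookup σ a < lookup σ b → toℕ (lookup w (triple x<y y<z z≤m a)) < toℕ (lookup w (triple x<y y<z z≤m b))
    triple-order x<y y<z z≤m σ order a b σᵃ<σᵇ =
      subst₂ _<_ (sym (trans (w≗f _) (cong f (toℕ-triple x<y y<z z≤m a))))
                 (sym (trans (w≗f _) (cong f (toℕ-triple x<y y<z z≤m b)))) (order a b σᵃ<σᵇ)

  avoids312⇔ : Avoids p312 w ⇔ (∀ {x y z} → z ≤ m → ¬ Pattern312 f x y z)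
  avoids312⇔ = mk⇔ noPattern noOccurrence
    where
    noPattern : Avoids p312 w → ∀ {x y z} → z ≤ m → ¬ Pattern312 f x y z
    noPattern avoid z≤m (x<y , y<z , fʸ<fᶻ , fᶻ<fˣ) =
      avoid (contains-intro p312 p312-injective w (triple x<y y<z z≤m) (triple-mono x<y y<z z≤m)
                            (triple-order x<y y<z z≤m p312 order))
      where
      order : ∀ a b → lookup p312 a < lookup p312 b → f (lookup (_ ∷ _ ∷ _ ∷ []) a) < f (lookup (_ ∷ _ ∷ _ ∷ []) b)
      order (fsuc fzero)        (fsuc (fsuc fzero)) _ = fʸ<fᶻ
      order (fsuc fzero)        fzero               _ = <-trans fʸ<fᶻ fᶻ<fˣ
      order (fsuc (fsuc fzero)) fzero               _ = fᶻ<fˣ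
      order fzero               fzero               (s≤s (s≤s (s≤s ())))
      order fzero               (fsuc fzero)        (s≤s ())
      order (fsuc fzero)        (fsuc fzero)        (s≤s ())
      order (fsuc (fsuc fzero)) (fsuc fzero)        (s≤s ())
      order fzero               (fsuc (fsuc fzero)) (s≤s (s≤s ()))
      order (fsuc (fsuc fzero)) (fsuc (fsuc fzero)) (s≤s (s≤s ()))
    noOccurrence : (∀ {x y z} → z ≤ m → ¬ Pattern312 f x y z) → Avoids p312 w
    noOccurrence noPat occ@(_ , mono , _) =
      noPat (occurrence-≤m p312 occ) (mono f₀ f₁ z<s , mono f₁ f₂ (s<s z<s) ,
        occurrence-order p312 occ f₁ f₂ (s<s z<s) , occurrence-order p312 occ f₂ f₀ (s<s (s<s z<s)))

  avoids231⇔ : Avoids p231 w ⇔ (∀ {i j l} → l ≤ m → ¬ Pattern231 f i j l)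
  avoids231⇔ = mk⇔ noPattern noOccurrence
    where
    noPattern : Avoids p231 w → ∀ {i j l} → l ≤ m → ¬ Pattern231 f i j l
    noPattern avoid l≤m (i<j , j<l , fˡ<fⁱ , fⁱ<fʲ) =
      avoid (contains-intro p231 p231-injective w (triple i<j j<l l≤m) (triple-mono i<j j<l l≤m)
                            (triple-order i<j j<l l≤m p231 order))
      where
      order : ∀ a b → lookup p231 a < lookup p231 b → f (lookup (_ ∷ _ ∷ _ ∷ []) a) < f (lookup (_ ∷ _ ∷ _ ∷ []) b)
      order (fsuc (fsuc fzero)) fzero               _ = fˡ<fⁱ
      order (fsuc (fsuc fzero)) (fsuc fzero)        _ = <-trans fˡ<fⁱ fⁱ<fʲ
      order fzero               (fsuc fzero)        _ = fⁱ<fʲ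
      order fzero               fzero               (s≤s (s≤s ()))
      order fzero               (fsuc (fsuc fzero)) (s≤s ())
      order (fsuc fzero)        fzero               (s≤s (s≤s ()))
      order (fsuc fzero)        (fsuc fzero)        (s≤s (s≤s (s≤s ())))
      order (fsuc fzero)        (fsuc (fsuc fzero)) (s≤s ())
      order (fsuc (fsuc fzero)) (fsuc (fsuc fzero)) (s≤s ())
    noOccurrence : (∀ {i j l} → l ≤ m → ¬ Pattern231 f i j l) → Avoids p231 w
    noOccurrence noPat occ@(_ , mono , _) =
      noPat (occurrence-≤m p231 occ) (mono f₀ f₁ z<s , mono f₁ f₂ (s<s z<s) ,
        occurrence-order p231 occ f₂ f₀ (s<s z<s) , occurrence-order p231 occ f₀ f₁ (s<s (s<s z<s)))

-- Orbits of cyclic permutations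

iter-+ : ∀ {A : Set} (f : A → A) a b x → iter f (a + b) x ≡ iter f a (iter f b x)
iter-+ f zero    b x = refl
iter-+ f (suc a) b x = cong f (iter-+ f a b x)

module _ {m : ℕ} (π : Vec (Fin (suc m)) (suc m)) where

  perm : ℕ → ℕ
  perm x = toℕ (lookup π (fin x))

  orbit : ℕ → ℕ
  orbit i = iter perm i 0

  perm-≤ : ∀ x → perm x ≤ m
  perm-≤ x = m<1+n⇒m≤n (toℕ<n (lookup π (fin x)))

  orbit-≤ : ∀ i → orbit i ≤ m
  orbit-≤ zero    = z≤n
  orbit-≤ (suc i) = perm-≤ (orbit i)

  toℕ-lookup : ∀ a → toℕ (lookup π a) ≡ perm (toℕ a)
  toℕ-lookup a = cong (λ b → toℕ (lookup π b)) (sym (fin-toℕ a))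

  toℕ-iter : ∀ k → toℕ (iter (app π) k fzero) ≡ orbit k
  toℕ-iter zero    = refl
  toℕ-iter (suc k) = trans (toℕ-lookup (iter (app π) k fzero)) (cong perm (toℕ-iter k))

  toℕ-cycleNotation : ∀ a → toℕ (lookup (cycleNotation π) a) ≡ orbit (toℕ a)
  toℕ-cycleNotation a = trans (cong toℕ (lookup∘tabulate (λ i → iter (app π) (toℕ i) fzero) a)) (toℕ-iter (toℕ a))

module _ {m : ℕ} {π : Vec (Fin (suc m)) (suc m)} (cyclic : IsCyclic π) where

  private
    p = perm π
    c = orbit π

  perm-injective : ∀ {x y} → x ≤ m → y ≤ m → p x ≡ p y → x ≡ y
  perm-injective {x} {y} x≤m y≤m eq =
    trans (sym (toℕ-fin x≤m)) (trans (cong toℕ (proj₁ cyclic (toℕ-injective eq))) (toℕ-fin y≤m))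

  orbit-cancel : ∀ i d → c (i + d) ≡ c i → c d ≡ 0
  orbit-cancel zero    d eq = eq
  orbit-cancel (suc i) d eq = orbit-cancel i d (perm-injective (orbit-≤ π (i + d)) (orbit-≤ π i) eq)

  orbit-multiple : ∀ d → c d ≡ 0 → ∀ q → c (q * d) ≡ 0
  orbit-multiple d ret zero    = refl
  orbit-multiple d ret (suc q) = trans (iter-+ p d (q * d) 0) (trans (cong (iter p d) (orbit-multiple d ret q)) ret)

  orbit-mod : ∀ d → .{{_ : NonZero d}} → c d ≡ 0 → ∀ k → c k ≡ c (k % d)
  orbit-mod d ret k = begin
    c k                               ≡⟨ cong c (m≡m%n+[m/n]*n k d) ⟩
    c (k % d + k / d * d)             ≡⟨ iter-+ p (k % d) (k / d * d) 0 ⟩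
    iter p (k % d) (c (k / d * d))    ≡⟨ cong (iter p (k % d)) (orbit-multiple d ret (k / d)) ⟩
    c (k % d)                         ∎
    where open ≡-Reasoning

  private
    hitTime : Fin (suc m) → ℕ
    hitTime a = proj₁ (proj₂ cyclic a)

    orbit-hitTime : ∀ a → c (hitTime a) ≡ toℕ a
    orbit-hitTime a = trans (sym (toℕ-iter π (hitTime a))) (cong toℕ (proj₂ (proj₂ cyclic a)))

  -- Otherwise the orbit would take at most d < m + 1 values.
  orbit-no-early-return : ∀ d → 0 < d → d ≤ m → c d ≢ 0
  orbit-no-early-return d@(suc _) _ d≤m ret with pigeonhole (s≤s d≤m) (λ a → fromℕ< (m%n<n (hitTime a) d))
  ... | a , b , a<b , eq = <-irrefl (begin
    toℕ a                  ≡⟨ orbit-hitTime a ⟨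
    c (hitTime a)          ≡⟨ orbit-mod d ret (hitTime a) ⟩
    c (hitTime a % d)      ≡⟨ cong c (trans (sym (toℕ-fromℕ< _)) (trans (cong toℕ eq) (toℕ-fromℕ< _))) ⟩
    c (hitTime b % d)      ≡⟨ orbit-mod d ret (hitTime b) ⟨
    c (hitTime b)          ≡⟨ orbit-hitTime b ⟩
    toℕ b                  ∎) a<b
    where open ≡-Reasoning

  orbit-no-repeat : ∀ {i j} → i < j → j ≤ m → c i ≢ c j
  orbit-no-repeat {i} i<j j≤m eq with m≤n⇒∃[o]m+o≡n i<j
  ... | d , refl = orbit-no-early-return (suc d) z<s (≤-trans (s≤s (m≤n+m d i)) j≤m)
                     (orbit-cancel i (suc d) (trans (cong c (+-suc i d)) (sym eq)))

  orbit-injective : ∀ {i j} → i ≤ m → j ≤ m → c i ≡ c j → i ≡ j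
  orbit-injective {i} {j} i≤m j≤m eq with <-cmp i j
  ... | tri< i<j _ _ = ⊥-elim (orbit-no-repeat i<j j≤m eq)
  ... | tri≈ _ i≡j _ = i≡j
  ... | tri> _ _ j<i = ⊥-elim (orbit-no-repeat j<i i≤m (sym eq))

  orbit-return-time : ∀ d → c (suc d) ≡ 0 → suc d ≤ suc m → d ≡ m
  orbit-return-time d ret 1+d≤1+m with suc d ≤? m
  ... | yes 1+d≤m = ⊥-elim (orbit-no-early-return (suc d) z<s 1+d≤m ret)
  ... | no  1+d≰m = ≤-antisym (≤-pred 1+d≤1+m) (≤-pred (≰⇒> 1+d≰m))

  -- Among c 0, …, c (m + 1) two values coincide, and their distance is a return time.
  orbit-return : c (suc m) ≡ 0
  orbit-return with pigeonhole (n<1+n (suc m)) (λ a → iter (app π) (toℕ a) fzero)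
  ... | a , b , a<b , eq with m≤n⇒∃[o]m+o≡n a<b
  ...   | d , b≡ = subst (λ k → c (suc k) ≡ 0) (orbit-return-time d ret 1+d≤1+m) ret
    where
    ret : c (suc d) ≡ 0
    ret = orbit-cancel (toℕ a) (suc d) (trans (cong c (trans (+-suc (toℕ a) d) b≡))
            (trans (sym (toℕ-iter π (toℕ b))) (trans (cong toℕ (sym eq)) (toℕ-iter π (toℕ a)))))
    1+d≤1+m : suc d ≤ suc m
    1+d≤1+m = ≤-trans (s≤s (m≤n+m d (toℕ a))) (≤-trans (≤-reflexive b≡) (m<1+n⇒m≤n (toℕ<n b)))

  orbit-surjective : ∀ {y} → y ≤ m → Σ[ i ∈ ℕ ] i ≤ m × c i ≡ y
  orbit-surjective {y} y≤m =
    hitTime (fin y) % suc m , m<1+n⇒m≤n (m%n<n (hitTime (fin y)) (suc m)) ,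
    trans (sym (orbit-mod (suc m) orbit-return (hitTime (fin y)))) (trans (orbit-hitTime (fin y)) (toℕ-fin y≤m))

-- From compositions to permutations

encode : ∀ m → List ℕ → Vec (Fin (suc m)) (suc m)
encode m ts = tabulate (λ a → fin (oneLine ts 0 (toℕ a)))

module _ {ts : List ℕ} (parts : All Part ts) where

  private
    m = sum ts
    π = encode m ts
    pos : Positive ts
    pos = All.map Part⇒0< parts

  oneLine-≤ : ∀ {x} → x ≤ m → oneLine ts 0 x ≤ m
  oneLine-≤ {x} x≤m with x <? m
  ... | yes x<m = proj₂ (oneLine-range 0 pos z≤n x<m)
  ... | no  x≮m rewrite ≤-antisym x≤m (≮⇒≥ x≮m) | oneLine-end ts 0 = z≤n

  perm-encode : ∀ {x} → x ≤ m → perm π x ≡ oneLine ts 0 x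
  perm-encode {x} x≤m = begin
    toℕ (lookup π (fin x))                      ≡⟨ cong toℕ (lookup∘tabulate (λ a → fin {m} (oneLine ts 0 (toℕ a))) (fin x)) ⟩
    toℕ (fin {m} (oneLine ts 0 (toℕ (fin {m} x)))) ≡⟨ cong (λ y → toℕ (fin {m} (oneLine ts 0 y))) (toℕ-fin x≤m) ⟩
    toℕ (fin {m} (oneLine ts 0 x))              ≡⟨ toℕ-fin (oneLine-≤ x≤m) ⟩
    oneLine ts 0 x                              ∎
    where open ≡-Reasoning

  orbit-encode : ∀ {i} → i ≤ m → orbit π i ≡ cycleWord ts 0 i
  orbit-encode {zero}  _     = sym (cycleWord-self 0 pos)
  orbit-encode {suc i} 1+i≤m = begin
    perm π (orbit π i)               ≡⟨ cong (perm π) (orbit-encode i≤m) ⟩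
    perm π (cycleWord ts 0 i)        ≡⟨ perm-encode (cycleWord-≤ 0 pos z≤n i≤m) ⟩
    oneLine ts 0 (cycleWord ts 0 i)  ≡⟨ oneLine-cycleWord 0 pos z≤n 1+i≤m ⟩
    cycleWord ts 0 (suc i)           ∎
    where
    open ≡-Reasoning
    i≤m = <⇒≤ 1+i≤m

  private
    W = cycleWord ts 0

    oneLine-W : ∀ {i} → i ≤ m → (i < m × oneLine ts 0 (W i) ≡ W (suc i)) ⊎ (i ≡ m × oneLine ts 0 (W i) ≡ W 0)
    oneLine-W {i} i≤m with i <? m
    ... | yes i<m = inj₁ (i<m , oneLine-cycleWord 0 pos z≤n i<m)
    ... | no  i≮m rewrite ≤-antisym i≤m (≮⇒≥ i≮m) =
      inj₂ (refl , trans (cong (oneLine ts 0) (cycleWord-end ts 0)) (trans (oneLine-end ts 0) (sym (cycleWord-self 0 pos))))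

    W-injective : ∀ {i j} → i ≤ m → j ≤ m → W i ≡ W j → i ≡ j
    W-injective = cycleWord-injective 0 pos z≤n z≤n

  oneLine-injective : ∀ {x y} → x ≤ m → y ≤ m → oneLine ts 0 x ≡ oneLine ts 0 y → x ≡ y
  oneLine-injective x≤m y≤m eq
    with cycleWord-cover 0 pos z≤n x≤m | cycleWord-cover 0 pos z≤n y≤m
  ... | i , _ , i≤m , refl | j , _ , j≤m , refl with oneLine-W i≤m | oneLine-W j≤m
  ...   | inj₁ (i<m , Pᵢ) | inj₁ (j<m , Pⱼ) = cong W (suc-injective (W-injective i<m j<m (trans (sym Pᵢ) (trans eq Pⱼ))))
  ...   | inj₁ (i<m , Pᵢ) | inj₂ (_ , Pⱼ)   = ⊥-elim (1+n≢0 (W-injective i<m z≤n (trans (sym Pᵢ) (trans eq Pⱼ))))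
  ...   | inj₂ (_ , Pᵢ)   | inj₁ (j<m , Pⱼ) = ⊥-elim (1+n≢0 (W-injective j<m z≤n (trans (sym Pⱼ) (trans (sym eq) Pᵢ))))
  ...   | inj₂ (refl , _) | inj₂ (refl , _) = refl

  encode-isPerm : IsPerm π
  encode-isPerm {a} {b} eq = toℕ-injective (oneLine-injective (toℕ≤m a) (toℕ≤m b) (begin
    oneLine ts 0 (toℕ a)  ≡⟨ perm-encode (toℕ≤m a) ⟨
    perm π (toℕ a)        ≡⟨ toℕ-lookup π a ⟨
    toℕ (lookup π a)      ≡⟨ cong toℕ eq ⟩
    toℕ (lookup π b)      ≡⟨ toℕ-lookup π b ⟩
    perm π (toℕ b)        ≡⟨ perm-encode (toℕ≤m b) ⟩
    oneLine ts 0 (toℕ b)  ∎))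
    where
    open ≡-Reasoning
    toℕ≤m : (a : Fin (suc m)) → toℕ a ≤ m
    toℕ≤m a = m<1+n⇒m≤n (toℕ<n a)

  encode-isCyclic : IsCyclic π
  encode-isCyclic = encode-isPerm , λ a → let i , _ , i≤m , Wᵢ≡a = cycleWord-cover 0 pos z≤n (m<1+n⇒m≤n (toℕ<n a)) in
    i , toℕ-injective (trans (toℕ-iter π i) (trans (orbit-encode i≤m) Wᵢ≡a))

  encode-avoids312 : Avoids p312 π
  encode-avoids312 = Equivalence.from (avoids312⇔ π (perm π) (toℕ-lookup π)) λ z≤m pat →
    oneLine-avoids312 0 pos z≤n z≤m (Pattern312-cong (λ k k≤z → perm-encode (≤-trans k≤z z≤m)) pat)

  encode-avoids231 : Avoids p231 (cycleNotation π)
  encode-avoids231 = Equivalence.from (avoids231⇔ (cycleNotation π) (orbit π) (toℕ-cycleNotation π)) λ l≤m pat →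
    cycleWord-avoids231 0 pos z≤n l≤m (Pattern231-cong (λ k k≤l → orbit-encode (≤-trans k≤l l≤m)) pat)

encode-∈A : ∀ {m ts} → IsComp m ts → InA p312 p231 (encode m ts)
encode-∈A (parts , refl) = encode-isCyclic parts , encode-avoids312 parts , encode-avoids231 parts

encode-injective : ∀ {m ts us} → IsComp m ts → IsComp m us → encode m ts ≡ encode m us → ts ≡ us
encode-injective {m} {ts} {us} ts∈ us∈ eq =
  oneLine-determines-parts 0 (proj₁ ts∈) (proj₁ us∈) (trans (proj₂ ts∈) (sym (proj₂ us∈))) same
  where
  perm-encode′ : ∀ {m ts x} → IsComp m ts → x ≤ m → perm (encode m ts) x ≡ oneLine ts 0 x
  perm-encode′ (parts , refl) = perm-encode parts
  same : ∀ x → 0 ≤ x → x < sum ts → oneLine ts 0 x ≡ oneLine us 0 x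
  same x _ x<m = trans (sym (perm-encode′ ts∈ x≤m)) (trans (cong (λ π → perm π x) eq) (perm-encode′ us∈ x≤m))
    where x≤m = <⇒≤ (subst (x <_) (proj₂ ts∈) x<m)

-- From permutations to compositions

module Decomposition {m : ℕ} {π : Vec (Fin (suc m)) (suc m)} (inA : InA p312 p231 π) where

  private
    p c : ℕ → ℕ
    p = perm π
    c = orbit π

    cyclic = proj₁ inA

    no312 : ∀ {x y w} → w ≤ m → ¬ Pattern312 p x y w
    no312 = Equivalence.to (avoids312⇔ π p (toℕ-lookup π)) (proj₁ (proj₂ inA))

    no231 : ∀ {i j l} → l ≤ m → ¬ Pattern231 c i j l
    no231 = Equivalence.to (avoids231⇔ (cycleNotation π) c (toℕ-cycleNotation π)) (proj₂ (proj₂ inA))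

    c-injective : ∀ {i j} → i ≤ m → j ≤ m → c i ≡ c j → i ≡ j
    c-injective = orbit-injective {π = π} cyclic

    c-surjective : ∀ {y} → y ≤ m → Σ[ i ∈ ℕ ] i ≤ m × c i ≡ y
    c-surjective = orbit-surjective {π = π} cyclic

    c-≢ : ∀ {i j} → i ≤ m → j ≤ m → i ≢ j → c i ≢ c j
    c-≢ i≤m j≤m i≢j = i≢j ∘ c-injective i≤m j≤m

  Closed : ℕ → Set
  Closed w = (∀ {i} → i ≤ w → c i ≤ w) × (∀ {y} → y ≤ w → Σ[ i ∈ ℕ ] i ≤ w × c i ≡ y)

  closed-beyond : ∀ {w i} → Closed w → w < i → i ≤ m → w < c i
  closed-beyond {w} {i} (_ , covers) w<i i≤m with w <? c i
  ... | yes w<cᵢ = w<cᵢ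
  ... | no  w≮cᵢ with covers (≮⇒≥ w≮cᵢ)
  ...   | i′ , i′≤w , cᵢ′≡cᵢ = ⊥-elim (<⇒≱ w<i (subst (_≤ w) (c-injective (≤-trans i′≤w (≤-trans (<⇒≤ w<i) i≤m)) i≤m cᵢ′≡cᵢ) i′≤w))

  closed-extend : ∀ {v w} → Closed v → v ≤ w →
                  (∀ {i} → v < i → i ≤ w → c i ≤ w) → (∀ {y} → v < y → y ≤ w → Σ[ i ∈ ℕ ] i ≤ w × c i ≡ y) → Closed w
  closed-extend {v} {w} (bounded , covers) v≤w boundedᵥʷ coversᵥʷ = bounded′ , covers′
    where
    bounded′ : ∀ {i} → i ≤ w → c i ≤ w
    bounded′ {i} i≤w with i ≤? v
    ... | yes i≤v = ≤-trans (bounded i≤v) v≤w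
    ... | no  i≰v = boundedᵥʷ (≰⇒> i≰v) i≤w
    covers′ : ∀ {y} → y ≤ w → Σ[ i ∈ ℕ ] i ≤ w × c i ≡ y
    covers′ {y} y≤w with y ≤? v
    ... | yes y≤v = let i , i≤v , cᵢ≡y = covers y≤v in i , ≤-trans i≤v v≤w , cᵢ≡y
    ... | no  y≰v = coversᵥʷ (≰⇒> y≰v) y≤w

  Prefix : ℕ → Set
  Prefix v = Closed v × c v ≡ v

  Decomposed : ℕ → Set
  Decomposed v = Σ[ ts ∈ List ℕ ] All Part ts × v + sum ts ≡ m × (∀ {i} → v ≤ i → i ≤ m → c i ≡ cycleWord ts v i)

  module Block {v : ℕ} (prefix : Prefix v) (v<m : v < m) where

    private
      k = c (suc v)

      k≤m : k ≤ m
      k≤m = orbit-≤ π (suc v)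

      pᵥ≡k : p v ≡ k
      pᵥ≡k = cong p (sym (proj₂ prefix))

    -- 231-avoidance of the cycle, with k in the role of 2, at positions after suc v.
    before : ∀ {j l} → suc v < j → j < l → l ≤ m → c l < k → c j < k
    before {j} 1+v<j j<l l≤m cₗ<k with <-cmp (c j) k
    ... | tri< cⱼ<k _ _ = cⱼ<k
    ... | tri≈ _ cⱼ≡k _ = ⊥-elim (c-≢ (≤-trans (<⇒≤ j<l) l≤m) v<m (≢-sym (<⇒≢ 1+v<j)) cⱼ≡k)
    ... | tri> _ _ k<cⱼ = ⊥-elim (no231 l≤m (1+v<j , j<l , cₗ<k , k<cⱼ))

    -- From position idx on, the block still has to visit exactly the values of [lo, lo + n].
    record Unvisited (lo n idx : ℕ) : Set where
      field
        v<lo   : v < lo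
        v<idx  : v < idx
        top≤k  : lo + n ≤ k
        notYet : ∀ {i} → i ≤ m → lo ≤ c i → c i ≤ lo + n → idx ≤ i
        inside : ∀ {i} → idx ≤ i → i ≤ m → c i < k → lo ≤ c i × c i ≤ lo + n

    -- After the top lo + n of the unvisited values comes their bottom lo: otherwise, with q
    -- the value visited just before lo, the positions v < q < lo + n would form a 312.
    step-bottom : ∀ {lo n idx} → Unvisited lo (suc n) idx → c idx ≡ lo + suc n → c (suc idx) ≡ lo
    step-bottom {lo} {n} {idx} u cᵢₔₓ≡top with c-surjective (≤-trans (m≤m+n lo (suc n)) (≤-trans (Unvisited.top≤k u) k≤m))
    ... | zero   , _    , c₀≡lo = ⊥-elim (n≮0 (subst (v <_) (sym c₀≡lo) (Unvisited.v<lo u)))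
    ... | suc i₁ , i₀≤m , cᵢ₀≡lo with suc i₁ ≟ suc idx
    ...   | yes i₀≡1+idx = subst (λ i → c i ≡ lo) i₀≡1+idx cᵢ₀≡lo
    ...   | no  i₀≢1+idx = ⊥-elim (no312 top≤m (v<q , q<top , pq<ptop , ptop<pv))
      where
      open Unvisited u
      top = lo + suc n
      top≤m = ≤-trans top≤k k≤m
      lo<k = <-≤-trans (m<m+n lo z<s) top≤k
      idx≤i₀ : idx ≤ suc i₁
      idx≤i₀ = notYet i₀≤m (≤-reflexive (sym cᵢ₀≡lo)) (subst (_≤ top) (sym cᵢ₀≡lo) (m≤m+n lo (suc n)))
      idx<i₁ : idx < i₁
      idx<i₁ = ≤-pred (≤∧≢⇒< (≤∧≢⇒< idx≤i₀ λ idx≡i₀ → m+1+n≢m lo (trans (sym cᵢₔₓ≡top) (trans (cong c idx≡i₀) cᵢ₀≡lo)))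
                             (≢-sym i₀≢1+idx))
      i₁≤m = ≤-trans (n≤1+n i₁) i₀≤m
      a<k : c (suc idx) < k
      a<k = before (s≤s v<idx) (s≤s idx<i₁) i₀≤m (subst (_< k) (sym cᵢ₀≡lo) lo<k)
      lo<a : lo < c (suc idx)
      lo<a = ≤∧≢⇒< (proj₁ (inside (n≤1+n idx) (≤-trans idx<i₁ i₁≤m) a<k))
                   (λ lo≡a → c-≢ (≤-trans idx<i₁ i₁≤m) i₀≤m (<⇒≢ (s≤s idx<i₁)) (trans (sym lo≡a) (sym cᵢ₀≡lo)))
      q<k : c i₁ < k
      q<k = before (≤-<-trans v<idx idx<i₁) (n<1+n i₁) i₀≤m (subst (_< k) (sym cᵢ₀≡lo) lo<k)
      v<q : v < c i₁
      v<q = <-≤-trans v<lo (proj₁ (inside (<⇒≤ idx<i₁) i₁≤m q<k))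
      q<top : c i₁ < top
      q<top = ≤∧≢⇒< (proj₂ (inside (<⇒≤ idx<i₁) i₁≤m q<k))
                    (λ q≡top → c-≢ i₁≤m (≤-trans (<⇒≤ idx<i₁) i₁≤m) (≢-sym (<⇒≢ idx<i₁)) (trans q≡top (sym cᵢₔₓ≡top)))
      pq<ptop : p (c i₁) < p top
      pq<ptop = subst₂ _<_ (sym cᵢ₀≡lo) (cong p cᵢₔₓ≡top) lo<a
      ptop<pv : p top < p v
      ptop<pv = subst₂ _<_ (cong p cᵢₔₓ≡top) (sym pᵥ≡k) a<k

    -- Symmetrically, after lo comes the next top: otherwise v < lo < q would form a 312.
    step-top : ∀ {lo n idx} → Unvisited lo (suc (suc n)) idx → c idx ≡ lo + suc (suc n) → c (suc idx) ≡ lo →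
               c (suc (suc idx)) ≡ lo + suc n
    step-top {lo} {n} {idx} u cᵢₔₓ≡top c₁₊ᵢₔₓ≡lo
      with c-surjective (≤-trans (+-monoʳ-≤ lo (n≤1+n (suc n))) (≤-trans (Unvisited.top≤k u) k≤m))
    ... | zero   , _    , c₀≡h = ⊥-elim (n≮0 (subst (v <_) (sym c₀≡h) (<-≤-trans (Unvisited.v<lo u) (m≤m+n lo (suc n)))))
    ... | suc i₂ , i₀≤m , cᵢ₀≡h with suc i₂ ≟ suc (suc idx)
    ...   | yes i₀≡2+idx = subst (λ i → c i ≡ lo + suc n) i₀≡2+idx cᵢ₀≡h
    ...   | no  i₀≢2+idx = ⊥-elim (no312 q≤m (v<lo , lo<q , plo<pq , pq<pv))
      where
      open Unvisited u
      h = lo + suc n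
      h<top : h < lo + suc (suc n)
      h<top = +-monoʳ-< lo (n<1+n (suc n))
      h<k = <-≤-trans h<top top≤k
      idx≤i₀ : idx ≤ suc i₂
      idx≤i₀ = notYet i₀≤m (subst (lo ≤_) (sym cᵢ₀≡h) (m≤m+n lo (suc n))) (subst (_≤ lo + suc (suc n)) (sym cᵢ₀≡h) (<⇒≤ h<top))
      1+idx<i₂ : suc idx < i₂
      1+idx<i₂ = ≤-pred (≤∧≢⇒< (≤∧≢⇒< (≤∧≢⇒< idx≤i₀
        (λ idx≡i₀ → <⇒≢ h<top (trans (sym cᵢ₀≡h) (trans (cong c (sym idx≡i₀)) cᵢₔₓ≡top))))
        (λ 1+idx≡i₀ → m+1+n≢m lo (trans (sym cᵢ₀≡h) (trans (cong c (sym 1+idx≡i₀)) c₁₊ᵢₔₓ≡lo))))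
        (≢-sym i₀≢2+idx))
      i₂≤m = ≤-trans (n≤1+n i₂) i₀≤m
      2+idx≤m = ≤-trans 1+idx<i₂ i₂≤m
      b<k : c (suc (suc idx)) < k
      b<k = before (s≤s (≤-trans v<idx (n≤1+n idx))) (s≤s 1+idx<i₂) i₀≤m (subst (_< k) (sym cᵢ₀≡h) h<k)
      idx≤2+idx = ≤-trans (n≤1+n idx) (n≤1+n (suc idx))
      b<top : c (suc (suc idx)) < lo + suc (suc n)
      b<top = ≤∧≢⇒< (proj₂ (inside idx≤2+idx 2+idx≤m b<k))
                    (λ b≡top → c-≢ 2+idx≤m (≤-trans idx≤2+idx 2+idx≤m) (≢-sym (<⇒≢ (n≤1+n (suc idx)))) (trans b≡top (sym cᵢₔₓ≡top)))
      b<h : c (suc (suc idx)) < h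
      b<h = ≤∧≢⇒< (m<1+n⇒m≤n (subst (c (suc (suc idx)) <_) (+-suc lo (suc n)) b<top))
                  (λ b≡h → c-≢ 2+idx≤m i₀≤m (<⇒≢ (s≤s 1+idx<i₂)) (trans b≡h (sym cᵢ₀≡h)))
      q<k : c i₂ < k
      q<k = before (≤-<-trans (≤-trans v<idx (n≤1+n idx)) 1+idx<i₂) (n<1+n i₂) i₀≤m (subst (_< k) (sym cᵢ₀≡h) h<k)
      lo<q : lo < c i₂
      lo<q = ≤∧≢⇒< (proj₁ (inside (≤-trans (n≤1+n idx) (<⇒≤ 1+idx<i₂)) i₂≤m q<k))
                   (λ lo≡q → c-≢ (≤-trans (<⇒≤ 1+idx<i₂) i₂≤m) i₂≤m (<⇒≢ 1+idx<i₂) (trans c₁₊ᵢₔₓ≡lo lo≡q))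
      q≤m = orbit-≤ π i₂
      plo<pq : p lo < p (c i₂)
      plo<pq = subst₂ _<_ (cong p c₁₊ᵢₔₓ≡lo) (sym cᵢ₀≡h) b<h
      pq<pv : p (c i₂) < p v
      pq<pv = subst₂ _<_ (sym cᵢ₀≡h) (sym pᵥ≡k) h<k

    unvisited-next : ∀ {lo n idx} → Unvisited lo (suc (suc n)) idx → c idx ≡ lo + suc (suc n) → c (suc idx) ≡ lo →
                     Unvisited (suc lo) n (suc (suc idx))
    unvisited-next {lo} {n} {idx} u cᵢₔₓ≡top c₁₊ᵢₔₓ≡lo = record
      { v<lo   = m<n⇒m<1+n v<lo
      ; v<idx  = m<n⇒m<1+n (m<n⇒m<1+n v<idx)
      ; top≤k  = ≤-trans (≤-reflexive (sym (+-suc lo n))) (≤-trans (+-monoʳ-≤ lo (n≤1+n (suc n))) top≤k)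
      ; notYet = notYet′
      ; inside = inside′
      }
      where
      open Unvisited u
      top = lo + suc (suc n)
      inner<top : ∀ {x} → x ≤ suc lo + n → x < top
      inner<top x≤ = ≤-<-trans x≤ (subst (_< top) (+-suc lo n) (+-monoʳ-< lo (n<1+n (suc n))))
      notYet′ : ∀ {i} → i ≤ m → suc lo ≤ c i → c i ≤ suc lo + n → suc (suc idx) ≤ i
      notYet′ {i} i≤m lo<cᵢ cᵢ≤ = ≤∧≢⇒< (≤∧≢⇒< (notYet i≤m (<⇒≤ lo<cᵢ) (<⇒≤ (inner<top cᵢ≤)))
                                             (λ idx≡i → <⇒≢ (inner<top cᵢ≤) (trans (cong c (sym idx≡i)) cᵢₔₓ≡top)))
                                      (λ 1+idx≡i → <⇒≢ lo<cᵢ (trans (sym c₁₊ᵢₔₓ≡lo) (cong c 1+idx≡i)))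
      inside′ : ∀ {i} → suc (suc idx) ≤ i → i ≤ m → c i < k → suc lo ≤ c i × c i ≤ suc lo + n
      inside′ {i} 2+idx≤i i≤m cᵢ<k =
        let lo≤cᵢ , cᵢ≤top = inside (≤-trans (n≤1+n idx) (≤-trans (n≤1+n (suc idx)) 2+idx≤i)) i≤m cᵢ<k
        in  ≤∧≢⇒< lo≤cᵢ (λ lo≡cᵢ → c-≢ (≤-trans (n≤1+n (suc idx)) (≤-trans 2+idx≤i i≤m)) i≤m
                                         (<⇒≢ 2+idx≤i) (trans c₁₊ᵢₔₓ≡lo lo≡cᵢ)) ,
            subst (c i ≤_) (+-suc lo n) (≤-pred (subst (c i <_) (+-suc lo (suc n))
              (≤∧≢⇒< cᵢ≤top (λ cᵢ≡top → c-≢ i≤m (≤-trans (n≤1+n idx) (≤-trans (n≤1+n (suc idx)) (≤-trans 2+idx≤i i≤m)))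
                                                  (≢-sym (<⇒≢ (≤-trans (n≤1+n (suc idx)) 2+idx≤i))) (trans cᵢ≡top (sym cᵢₔₓ≡top))))))

    zig : ∀ {lo n idx} → Unvisited lo n idx → c idx ≡ lo + n → ∀ j → j ≤ n → c (idx + j) ≡ zigzag lo (suc n) j
    zig {idx = idx} u cᵢₔₓ≡top zero _ = trans (cong c (+-identityʳ idx)) cᵢₔₓ≡top
    zig {n = suc n} {idx} u cᵢₔₓ≡top (suc zero) _ = trans (cong c (+-comm idx 1)) (step-bottom u cᵢₔₓ≡top)
    zig {lo} {suc (suc n)} {idx} u cᵢₔₓ≡top (suc (suc j)) (s≤s (s≤s j≤n)) = begin
      c (idx + suc (suc j))     ≡⟨ cong c (trans (+-suc idx (suc j)) (cong suc (+-suc idx j))) ⟩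
      c (suc (suc idx) + j)     ≡⟨ zig (unvisited-next u cᵢₔₓ≡top c₁₊ᵢₔₓ≡lo) c₂₊ᵢₔₓ≡top′ j j≤n ⟩
      zigzag (suc lo) (suc n) j ∎
      where
      open ≡-Reasoning
      c₁₊ᵢₔₓ≡lo = step-bottom u cᵢₔₓ≡top
      c₂₊ᵢₔₓ≡top′ : c (suc (suc idx)) ≡ suc lo + n
      c₂₊ᵢₔₓ≡top′ = trans (step-top u cᵢₔₓ≡top c₁₊ᵢₔₓ≡lo) (+-suc lo n)

    module Single (c[1+v]≡1+v : c (suc v) ≡ suc v) where

      prefix′ : Prefix (suc v)
      prefix′ = closed-extend (proj₁ prefix) (n≤1+n v)
                  (λ v<i i≤1+v → ≤-reflexive (trans (cong c (≤-antisym i≤1+v v<i)) c[1+v]≡1+v))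
                  (λ {y} v<y y≤1+v → suc v , ≤-refl , trans c[1+v]≡1+v (≤-antisym v<y y≤1+v)) ,
                c[1+v]≡1+v

      extend : Decomposed (suc v) → Decomposed v
      extend (ts , parts , sum≡ , agree) = 1 ∷ ts , one ∷ parts , trans (+-suc v (sum ts)) sum≡ , agree′
        where
        agree′ : ∀ {i} → v ≤ i → i ≤ m → c i ≡ cycleWord (1 ∷ ts) v i
        agree′ {i} v≤i i≤m with i ≟ v
        ... | yes refl = trans (proj₂ prefix) (sym (cycleWord-start ts i z<s))
        ... | no  i≢v  = trans (agree v<i i≤m) (trans (cong (λ w → cycleWord ts w i) (+-comm 1 v)) (sym (cycleWord-skip ts v v+1≤i)))
          where
          v<i = ≤∧≢⇒< v≤i (≢-sym i≢v)
          v+1≤i = subst (_≤ i) (+-comm 1 v) v<i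

    module Zigzag (n : ℕ) (k≡ : k ≡ suc v + suc n) where

      private
        unvisited : Unvisited (suc v) (suc n) (suc v)
        unvisited = record
          { v<lo   = n<1+n v
          ; v<idx  = n<1+n v
          ; top≤k  = ≤-reflexive (sym k≡)
          ; notYet = λ {i} _ v<cᵢ _ → ≰⇒> (λ i≤v → <⇒≱ v<cᵢ (proj₁ (proj₁ prefix) i≤v))
          ; inside = λ v<i i≤m cᵢ<k → closed-beyond (proj₁ prefix) v<i i≤m , ≤-trans (<⇒≤ cᵢ<k) (≤-reflexive k≡)
          }

      block-zigzag : ∀ j → j ≤ suc n → c (suc v + j) ≡ zigzag (suc v) (suc (suc n)) j
      block-zigzag = zig unvisited k≡

      private
        v<k : v < k
        v<k = subst (v <_) (sym k≡) (m≤m+n (suc v) (suc n))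

        1+v<k : suc v < k
        1+v<k = subst (suc v <_) (sym k≡) (m<m+n (suc v) z<s)

        pₖ≡1+v : p k ≡ suc v
        pₖ≡1+v = trans (cong c (+-comm 1 (suc v))) (block-zigzag 1 (s≤s z≤n))

        k-position : ∀ {i} → v < i → i ≤ k → Σ[ j ∈ ℕ ] j ≤ suc n × suc v + j ≡ i
        k-position {i} v<i i≤k =
          let j , 1+v+j≡i = m≤n⇒∃[o]m+o≡n v<i
          in  j , +-cancelˡ-≤ (suc v) j (suc n) (subst₂ _≤_ (sym 1+v+j≡i) k≡ i≤k) , 1+v+j≡i

        zigzag<1+k : ∀ {j} → j ≤ suc n → zigzag (suc v) (suc (suc n)) j < suc k
        zigzag<1+k {j} j≤ = subst (zigzag (suc v) (suc (suc n)) j <_) (trans (+-suc (suc v) (suc n)) (cong suc (sym k≡))) (proj₂ (zigzag-range (suc v) (suc (suc n)) _ (s≤s j≤)))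

        v<z : v < c k
        v<z = subst (v <_) (sym (trans (cong c k≡) (block-zigzag (suc n) ≤-refl))) (proj₁ (zigzag-range (suc v) (suc (suc n)) (suc n) ≤-refl))

        z<k : c k < k
        z<k = ≤∧≢⇒< (m<1+n⇒m≤n (subst (_< suc k) (sym (trans (cong c k≡) (block-zigzag (suc n) ≤-refl))) (zigzag<1+k ≤-refl)))
                    (c-≢ k≤m v<m (≢-sym (<⇒≢ 1+v<k)))

      k<m : k < m
      k<m with k <? m
      ... | yes k<m = k<m
      ... | no  k≮m = ⊥-elim (no312 k≤m (v<z , z<k , pz<pk , pk<pv))
        where
        pz<pk : p (c k) < p k
        pz<pk = subst₂ _<_ (sym (trans (cong (c ∘ suc) (≤-antisym k≤m (≮⇒≥ k≮m))) (orbit-return {π = π} cyclic))) (sym pₖ≡1+v) z<s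
        pk<pv : p k < p v
        pk<pv = subst₂ _<_ (sym pₖ≡1+v) (sym pᵥ≡k) 1+v<k

      closedₖ : Closed k
      closedₖ = closed-extend (proj₁ prefix) (<⇒≤ v<k) bounded covers
        where
        bounded : ∀ {i} → v < i → i ≤ k → c i ≤ k
        bounded v<i i≤k with k-position v<i i≤k
        ... | j , j≤ , refl = m<1+n⇒m≤n (subst (_< suc k) (sym (block-zigzag j j≤)) (zigzag<1+k j≤))
        covers : ∀ {y} → v < y → y ≤ k → Σ[ i ∈ ℕ ] i ≤ k × c i ≡ y
        covers {y} v<y y≤k with zigzag-cover (suc v) (suc (suc n)) y v<y (subst (y <_) (sym (trans (+-suc (suc v) (suc n)) (cong suc (sym k≡)))) (s≤s y≤k))
        ... | j , j<2+n , zⱼ≡y =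
          suc v + j , subst (suc v + j ≤_) (sym k≡) (+-monoʳ-≤ (suc v) (m<1+n⇒m≤n j<2+n)) , trans (block-zigzag j (m<1+n⇒m≤n j<2+n)) zⱼ≡y

      -- If c (k + 1) ≠ k + 1, then k + 1 is reached later, from some q > k, and z < k < q form a 312.
      c[1+k]≡1+k : c (suc k) ≡ suc k
      c[1+k]≡1+k with c (suc k) ≟ suc k | c-surjective k<m
      ... | yes c[1+k]≡1+k | _ = c[1+k]≡1+k
      ... | no  _ | zero , _ , c₀≡1+k = ⊥-elim (1+n≢0 (sym c₀≡1+k))
      ... | no  c[1+k]≢1+k | suc i , 1+i≤m , cᵢ₊₁≡1+k = ⊥-elim (no312 (orbit-≤ π i) (z<k , k<q , pk<pq , pq<pz))
        where
        k<1+i : k < suc i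
        k<1+i = ≰⇒> (λ 1+i≤k → <⇒≱ (n<1+n k) (subst (_≤ k) cᵢ₊₁≡1+k (proj₁ closedₖ 1+i≤k)))
        k<i : k < i
        k<i = ≤∧≢⇒< (m<1+n⇒m≤n k<1+i) (λ k≡i → c[1+k]≢1+k (trans (cong (c ∘ suc) k≡i) cᵢ₊₁≡1+k))
        k<q : k < c i
        k<q = closed-beyond closedₖ k<i (≤-trans (n≤1+n i) 1+i≤m)
        pk<pq : p k < p (c i)
        pk<pq = subst₂ _<_ (sym pₖ≡1+v) (sym cᵢ₊₁≡1+k) (s≤s (<⇒≤ 1+v<k))
        pq<pz : p (c i) < p (c k)
        pq<pz = subst (_< c (suc k)) (sym cᵢ₊₁≡1+k)
                  (≤∧≢⇒< (closed-beyond closedₖ (n<1+n k) k<m) (≢-sym c[1+k]≢1+k))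

      prefix′ : Prefix (suc k)
      prefix′ = closed-extend closedₖ (n≤1+n k) bounded covers , c[1+k]≡1+k
        where
        bounded : ∀ {i} → k < i → i ≤ suc k → c i ≤ suc k
        bounded k<i i≤1+k rewrite ≤-antisym i≤1+k k<i = ≤-reflexive c[1+k]≡1+k
        covers : ∀ {y} → k < y → y ≤ suc k → Σ[ i ∈ ℕ ] i ≤ suc k × c i ≡ y
        covers k<y y≤1+k rewrite ≤-antisym y≤1+k k<y = suc k , ≤-refl , c[1+k]≡1+k

      extend : Decomposed (suc k) → Decomposed v
      extend (ts , parts , sum≡ , agree) = t ∷ ts , big (s≤s (s≤s (s≤s z≤n))) ∷ parts , sum≡′ , agree′
        where
        t = suc (suc (suc n))
        v+t≡1+k : v + t ≡ suc k
        v+t≡1+k = trans (+-suc v (suc (suc n))) (cong suc (trans (+-suc v (suc n)) (sym k≡)))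
        sum≡′ : v + (t + sum ts) ≡ m
        sum≡′ = trans (sym (+-assoc v t (sum ts))) (trans (cong (_+ sum ts) v+t≡1+k) sum≡)
        agree′ : ∀ {i} → v ≤ i → i ≤ m → c i ≡ cycleWord (t ∷ ts) v i
        agree′ {i} v≤i i≤m with i <? v + t
        ... | no  i≮v+t = trans (agree (subst (_≤ i) v+t≡1+k (≮⇒≥ i≮v+t)) i≤m)
                            (trans (cong (λ w → cycleWord ts w i) (sym v+t≡1+k)) (sym (cycleWord-skip ts v (≮⇒≥ i≮v+t))))
        ... | yes i<v+t with inBlock v≤i i<v+t
        ...   | start       = trans (proj₂ prefix) (sym (cycleWord-start ts v z<s))
        ...   | inner j j<t = trans (block-zigzag j (m<1+n⇒m≤n j<t)) (sym (cycleWord-inBlock ts v j (inner-< j z<s j<t)))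

  private
    fuel-step : ∀ {v w fuel} → v < w → w ≤ m → m ∸ v < suc fuel → m ∸ w < fuel
    fuel-step v<w w≤m bound = <-≤-trans (∸-monoʳ-< v<w w≤m) (m<1+n⇒m≤n bound)

  decompose : ∀ fuel {v} → m ∸ v < fuel → v ≤ m → Prefix v → Decomposed v
  decompose (suc fuel) {v} bound v≤m prefix with v <? m
  ... | no v≮m rewrite ≤-antisym v≤m (≮⇒≥ v≮m) =
    [] , [] , +-identityʳ m , λ m≤i i≤m → trans (cong c (≤-antisym i≤m m≤i)) (trans (proj₂ prefix) (≤-antisym m≤i i≤m))
  ... | yes v<m with c (suc v) ≟ suc v
  ...   | yes c[1+v]≡1+v = extend (decompose fuel (fuel-step (n<1+n v) v<m bound) v<m prefix′)
    where open Block.Single prefix v<m c[1+v]≡1+v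
  ...   | no  c[1+v]≢1+v with m≤n⇒∃[o]m+o≡n (≤∧≢⇒< (closed-beyond (proj₁ prefix) (n<1+n v) v<m) (≢-sym c[1+v]≢1+v))
  ...     | n , 2+v+n≡k = extend (decompose fuel (fuel-step v<1+k k<m bound) k<m prefix′)
    where
    k≡ : c (suc v) ≡ suc v + suc n
    k≡ = trans (sym 2+v+n≡k) (sym (+-suc (suc v) n))
    open Block.Zigzag prefix v<m n k≡
    v<1+k : v < suc (c (suc v))
    v<1+k = s≤s (subst (v ≤_) (sym k≡) (m≤n⇒m≤1+n (m≤m+n v (suc n))))

  decomposition : Σ[ ts ∈ List ℕ ] IsComp m ts × (∀ {i} → i ≤ m → c i ≡ cycleWord ts 0 i)
  decomposition with decompose (suc m) (n<1+n m) z≤n prefix₀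
    where
    prefix₀ : Prefix 0
    prefix₀ = ((λ { z≤n → z≤n }) , (λ { z≤n → 0 , z≤n , refl })) , refl
  ... | ts , parts , sum≡ , agree = ts , (parts , sum≡) , agree z≤n

  perm-oneLine : Σ[ ts ∈ List ℕ ] IsComp m ts × (∀ {x} → x ≤ m → p x ≡ oneLine ts 0 x)
  perm-oneLine with decomposition
  ... | ts , (parts , refl) , c≗W = ts , (parts , refl) , p≗P
    where
    pos = All.map Part⇒0< parts
    p≗P : ∀ {x} → x ≤ m → p x ≡ oneLine ts 0 x
    p≗P x≤m with c-surjective x≤m
    ... | i , i≤m , refl with i <? m
    ...   | yes i<m = begin
      c (suc i)                       ≡⟨ c≗W i<m ⟩
      cycleWord ts 0 (suc i)          ≡⟨ oneLine-cycleWord 0 pos z≤n i<m ⟨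
      oneLine ts 0 (cycleWord ts 0 i) ≡⟨ cong (oneLine ts 0) (c≗W i≤m) ⟨
      oneLine ts 0 (c i)              ∎
      where open ≡-Reasoning
    ...   | no  i≮m rewrite ≤-antisym i≤m (≮⇒≥ i≮m) = begin
      c (suc m)                       ≡⟨ orbit-return {π = π} cyclic ⟩
      0                               ≡⟨ oneLine-end ts 0 ⟨
      oneLine ts 0 m                  ≡⟨ cong (oneLine ts 0) (trans (sym (cycleWord-end ts 0)) (sym (c≗W ≤-refl))) ⟩
      oneLine ts 0 (c m)              ∎
      where open ≡-Reasoning

decode : ∀ {m} {π : Vec (Fin (suc m)) (suc m)} → InA p312 p231 π → Σ[ ts ∈ List ℕ ] IsComp m ts × π ≡ encode m ts
decode {π = π} inA with Decomposition.perm-oneLine {π = π} inA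
... | ts , (parts , refl) , p≗P = ts , (parts , refl) , trans (sym (tabulate∘lookup π)) (tabulate-cong entry)
  where
  entry : ∀ a → lookup π a ≡ fin (oneLine ts 0 (toℕ a))
  entry a = toℕ-injective (trans (toℕ-lookup π a) (trans (p≗P a≤m) (sym (toℕ-fin (oneLine-≤ parts a≤m)))))
    where a≤m = m<1+n⇒m≤n (toℕ<n a)

-- The count

Unique-map⁺ : ∀ {A B : Set} (f : A → B) {xs : List A} → (∀ {x y} → x ∈ xs → y ∈ xs → f x ≡ f y → x ≡ y) →
              Unique xs → Unique (map f xs)
Unique-map⁺ f {[]}     _   []         = []
Unique-map⁺ f {x ∷ xs} inj (x∉ ∷ uniq) =
  All.map⁺ (All.tabulate (λ y∈ fx≡fy → All.lookup x∉ y∈ (inj (here refl) (there y∈) fx≡fy)))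
  ∷ Unique-map⁺ f (λ x∈ y∈ → inj (there x∈) (there y∈)) uniq

theorem4p19 : (m : ℕ) → HasCard {Vec (Fin (suc m)) (suc m)} (InA p312 p231) (rhs m)
theorem4p19 m = map (encode m) (comps m) , unique , (λ π → mk⇔ sound complete) , count
  where
  isComp : ∀ {ts} → ts ∈ comps m → IsComp m ts
  isComp = All.lookup (comps-sound m)
  unique = Unique-map⁺ (encode m) (λ ts∈ us∈ → encode-injective (isComp ts∈) (isComp us∈)) (comps-unique m)
  sound : ∀ {π} → π ∈ map (encode m) (comps m) → InA p312 p231 π
  sound π∈ with ∈-map⁻ (encode m) π∈
  ... | ts , ts∈ , refl = encode-∈A (isComp ts∈)
  complete : ∀ {π} → InA p312 p231 π → π ∈ map (encode m) (comps m)
  complete {π} inA with decode {π = π} inA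
  ... | ts , (parts , refl) , refl = ∈-map⁺ (encode m) (comps-complete parts)
  count = trans (length-map (encode m) (comps m)) (trans (length-comps m) (sym (rhs≡diagSum m)))
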